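{- Fix $k\in\mathbb Z_{\ge0}$ and an irreducible fraction $t\in(0,1)$. Then the Hirzebruch–Jung continued fraction expansion of $\dfrac{m_{k,t}}{u^-_{k,t}}$ is a dual $k$-Wahl chain.
   Context: Farey tree $\mathrm{F}\mathbb T$: root $\left(\frac01,\frac11,\frac10\right)$; vertex $\left(\frac ab,\frac cd,\frac ef\right)$ has left child $\left(\frac ab,\frac{a+c}{b+d},\frac cd\right)$ and right child $\left(\frac cd,\frac{c+e}{d+f},\frac ef\right)$. $\mathrm{M}\mathbb T(k)$: root $(1,k+2,1)$; vertex $(a,b,c)$ has left child $\left(a,\frac{a^2+kab+b^2}{c},b\right)$ and right child $\left(b,\frac{b^2+kbc+c^2}{a},c\right)$. Let $\theta\colon\mathrm{F}\mathbb T\to\mathrm{M}\mathbb T(k)$ be the bijection preserving root and left/right children. For irreducible $t\in(0,1)$ let $(r,t,s)$ be the vertex of $\mathrm{F}\mathbb T$ with middle entry $t$, $(m_r,m_t,m_s)=\theta(r,t,s)$, $m_{k,t}:=m_t$, and $u^-_{k,t}$ the unique $x\in(0,m_t)$ with $m_rx\equiv -m_s\pmod{m_t}$. Every rational $x>1$ has a unique Hirzebruch–Jung expansion $[[b_1,\dots,b_s]]:=b_1-\cfrac1{b_2-\cfrac1{\ddots-\cfrac1{b_s}}}$ with integers $b_i\ge2$. Dual $k$-Wahl chains are defined recursively: $[[2,\dots,2]]$ ($k+1$ entries equal to $2$) is a dual $k$-Wahl chain; if $[[b_1,\dots,b_\ell]]$ is one, so are $[[b_1+1,b_2,\dots,b_\ell,2]]$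 and $[[2,b_1,\dots,b_{\ell-1},b_\ell+1]]$. -}

module Defs where

open import Data.Nat using (ℕ; zero; suc; _+_; _*_; _<_; _≤_)
open import Data.Nat.DivMod using (_/_)
open import Data.Nat.Divisibility using (_∣_)
open import Data.Nat.Coprimality using (Coprime)
open import Data.Integer as ℤ using (ℤ; +_)
open import Data.List using (List; []; _∷_; _++_; [_]; replicate)
open import Data.List.Relation.Unary.All using (All)
open import Data.Product using (_×_; _,_; proj₁; proj₂)
open import Relation.Binary.PropositionalEquality using (_≡_)

-- Directions in a binary tree; a vertex is addressed by the path from the root
-- (first list element = first step taken from the root).
data Dir : Set where
  L R : Dir

Path : Set
Path = List Dir

-- A fraction a/b is represented by the pair (a , b) of naturals (1/0 = (1 , 0)).
Frac : Set
Frac = ℕ × ℕ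

record FTriple : Set where
  constructor ftri
  field
    fl fm fr : Frac
open FTriple public

fareyRoot : FTriple
fareyRoot = ftri (0 , 1) (1 , 1) (1 , 0)

fareyLeft : FTriple → FTriple
fareyLeft (ftri (a , b) (c , d) e) = ftri (a , b) (a + c , b + d) (c , d)

fareyRight : FTriple → FTriple
fareyRight (ftri a (c , d) (e , f)) = ftri (c , d) (c + e , d + f) (e , f)

fareyFrom : FTriple → Path → FTriple
fareyFrom v [] = v
fareyFrom v (L ∷ p) = fareyFrom (fareyLeft v) p
fareyFrom v (R ∷ p) = fareyFrom (fareyRight v) p

farey : Path → FTriple
farey = fareyFrom fareyRoot

record MTriple : Set where
  constructor mtri
  field
    ml mm mr : ℕ
open MTriple public

-- exact division n / c (in the tree the division is always exact and c > 0;
-- the value for c = 0 is an irrelevant junk value)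
divE : ℕ → ℕ → ℕ
divE n zero = 0
divE n (suc c) = n / suc c

mtRoot : ℕ → MTriple
mtRoot k = mtri 1 (k + 2) 1

mtLeft : ℕ → MTriple → MTriple
mtLeft k (mtri a b c) = mtri a (divE (a * a + k * a * b + b * b) c) b

mtRight : ℕ → MTriple → MTriple
mtRight k (mtri a b c) = mtri b (divE (b * b + k * b * c + c * c) a) c

mtFrom : ℕ → MTriple → Path → MTriple
mtFrom k v [] = v
mtFrom k v (L ∷ p) = mtFrom k (mtLeft k v) p
mtFrom k v (R ∷ p) = mtFrom k (mtRight k v) p

-- vertex of MT(k) at a given path; θ (farey p) = mt k p
mt : ℕ → Path → MTriple
mt k = mtFrom k (mtRoot k)

-- Value of a Hirzebruch–Jung continued fraction [[b₁,…,bₛ]] as a pair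
-- (numerator , denominator) of integers:
-- [[b]] = b/1 ,  [[b, rest]] = b - 1/[[rest]] = (b·N - D)/N  where [[rest]] = N/D.
hjVal : List ℕ → ℤ × ℤ
hjVal [] = (+ 0 , + 1)
hjVal (b ∷ []) = (+ b , + 1)
hjVal (b ∷ c ∷ bs) with hjVal (c ∷ bs)
... | (N , D) = ((+ b) ℤ.* N ℤ.- D , N)

IsHJExpansion : List ℕ → ℕ → ℕ → Set
IsHJExpansion bs n d =
  (bs ≢[]) × All (λ b → 2 ≤ b) bs ×
  (proj₁ (hjVal bs) ℤ.* (+ d) ≡ proj₂ (hjVal bs) ℤ.* (+ n))
  where
  _≢[] : List ℕ → Set
  [] ≢[] = 0 ≡ 1
  (_ ∷ _) ≢[] = 1 ≡ 1

data DualWahl (k : ℕ) : List ℕ → Set where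
  base  : DualWahl k (replicate (suc k) 2)
  stepL : ∀ {b bs} → DualWahl k (b ∷ bs) → DualWahl k (suc b ∷ (bs ++ [ 2 ]))
  stepR : ∀ {b bs} → DualWahl k (bs ++ [ b ]) → DualWahl k (2 ∷ (bs ++ [ suc b ]))

module Submission where

-- Work in SL₂(ℤ) with the companion matrix C of x² − k x + 1.  For B of determinant 1
-- with first row (a, b), the conjugate B C B⁻¹ has trace k and (1,2) entry a² + k a b + b².
-- A Hirzebruch–Jung chain is the product of the matrices [[b, −1], [1, 0]] over its
-- entries, with first column (numerator, denominator).  Up to a fixed factor, the chain
-- 2…2 of length k + 1 is the conjugate by [[1, 1], [0, 1]], and the two Wahl moves multiply
-- B on the left by two unimodular matrices; together with Euclid's algorithm this makes
-- every B with positive first row realised by a dual k-Wahl chain, up to a shear that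
-- changes the denominator by a multiple of the numerator.
-- Along MT(k) a vertex (l, m, r) carries three such conjugates with (1,2) entries l, m, r
-- whose product is lower unitriangular (a Cohn-type triple).  The exchange relations of
-- MT(k) follow, and the product gives l·D + r ≡ 0 (mod m) for the denominator D of the
-- chain realising the middle conjugate, once it is moved inside its stabiliser to a
-- positive first row.  Since gcd(l, m) = 1 and u, D < m, this forces D = u, and by
-- uniqueness of Hirzebruch–Jung expansions that chain is the expansion of m/u.

module Matrix where

  open import Data.Integer using (ℤ; +_; -_; _+_; _-_; _*_; 0ℤ; 1ℤ; -1ℤ)
  open import Data.Integer.Properties using (neg-involutive; +-identityʳ; *-zeroʳ; *-identityʳ; m-n≡m⊖n; ⊖-≥)
  open import Data.Integer.Tactic.RingSolver using (solve)
  open import Data.List using (List; _∷_; [])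
  import Data.Nat as ℕ
  open import Data.Product using (_×_; _,_)
  open import Relation.Binary.PropositionalEquality using (_≡_; refl; trans; cong; cong₂; module ≡-Reasoning)
  open ≡-Reasoning

  -- Without eta, a product of explicit matrices reduces to explicit entries, so
  -- entrywise identities become goals that the ring solver can read.
  record Mat : Set where
    no-eta-equality
    pattern
    constructor mk
    field
      m11 m12 m21 m22 : ℤ
  open Mat public

  infixl 7 _⊗_
  _⊗_ : Mat → Mat → Mat
  mk a b c d ⊗ mk e f g h = mk (a * e + b * g) (a * f + b * h) (c * e + d * g) (c * f + d * h)

  I : Mat
  I = mk 1ℤ 0ℤ 0ℤ 1ℤ

  adj : Mat → Mat
  adj (mk a b c d) = mk d (- b) (- c) a

  det : Mat → ℤ
  det (mk a b c d) = a * d - b * c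

  row : Mat → ℤ × ℤ
  row X = m11 X , m12 X

  column : Mat → ℤ × ℤ
  column X = m11 X , m21 X

  upper lower : Mat
  upper = mk 1ℤ 1ℤ 0ℤ 1ℤ
  lower = mk 1ℤ 0ℤ 1ℤ 1ℤ

  shear : ℤ → Mat
  shear n = mk 1ℤ 0ℤ n 1ℤ

  companion : ℤ → Mat
  companion z = mk 0ℤ 1ℤ -1ℤ z

  conj : ℤ → Mat → Mat
  conj z B = B ⊗ companion z ⊗ adj B

  form : ℤ → ℤ → ℤ → ℤ
  form z a b = a * a + z * a * b + b * b

  +m-+n≡+[m∸n] : ∀ {m n} → n ℕ.≤ m → + m - + n ≡ + (m ℕ.∸ n)
  +m-+n≡+[m∸n] {m} {n} n≤m = trans (m-n≡m⊖n m n) (⊖-≥ n≤m)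

  x+e*[d-1]≡x : ∀ x e d → d ≡ 1ℤ → x + e * (d - 1ℤ) ≡ x
  x+e*[d-1]≡x x e d refl = trans (cong (λ y → x + y) (*-zeroʳ e)) (+-identityʳ x)

  mk-cong : ∀ {a b c d a′ b′ c′ d′} → a ≡ a′ → b ≡ b′ → c ≡ c′ → d ≡ d′ → mk a b c d ≡ mk a′ b′ c′ d′
  mk-cong refl refl refl refl = refl

  ⊗-assoc : ∀ X Y Z → X ⊗ Y ⊗ Z ≡ X ⊗ (Y ⊗ Z)
  ⊗-assoc (mk a b c d) (mk e f g h) (mk p q r s) = mk-cong (solve vs) (solve vs) (solve vs) (solve vs)
    where
    vs : List ℤ
    vs = a ∷ b ∷ c ∷ d ∷ e ∷ f ∷ g ∷ h ∷ p ∷ q ∷ r ∷ s ∷ []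

  ⊗-identityˡ : ∀ X → I ⊗ X ≡ X
  ⊗-identityˡ (mk a b c d) = mk-cong (solve vs) (solve vs) (solve vs) (solve vs)
    where
    vs : List ℤ
    vs = a ∷ b ∷ c ∷ d ∷ []

  ⊗-identityʳ : ∀ X → X ⊗ I ≡ X
  ⊗-identityʳ (mk a b c d) = mk-cong (solve vs) (solve vs) (solve vs) (solve vs)
    where
    vs : List ℤ
    vs = a ∷ b ∷ c ∷ d ∷ []

  det-⊗ : ∀ X Y → det (X ⊗ Y) ≡ det X * det Y
  det-⊗ (mk a b c d) (mk e f g h) = begin
    (a * e + b * g) * (c * f + d * h) - (a * f + b * h) * (c * e + d * g)  ≡⟨ solve (a ∷ b ∷ c ∷ d ∷ e ∷ f ∷ g ∷ h ∷ []) ⟩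
    (a * d - b * c) * (e * h - f * g)                                      ∎

  det-⊗-≡1 : ∀ X Y → det X ≡ 1ℤ → det Y ≡ 1ℤ → det (X ⊗ Y) ≡ 1ℤ
  det-⊗-≡1 X Y detX≡1 detY≡1 = trans (det-⊗ X Y) (cong₂ _*_ detX≡1 detY≡1)

  det-adj : ∀ X → det (adj X) ≡ det X
  det-adj (mk a b c d) = begin
    d * a - - b * - c  ≡⟨ solve (a ∷ b ∷ c ∷ d ∷ []) ⟩
    a * d - b * c      ∎

  adj-⊗ : ∀ X Y → adj (X ⊗ Y) ≡ adj Y ⊗ adj X
  adj-⊗ (mk a b c d) (mk e f g h) = mk-cong (solve vs) (solve vs) (solve vs) (solve vs)
    where
    vs : List ℤ
    vs = a ∷ b ∷ c ∷ d ∷ e ∷ f ∷ g ∷ h ∷ []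

  adj-involutive : ∀ X → adj (adj X) ≡ X
  adj-involutive (mk a b c d) = mk-cong refl (neg-involutive b) (neg-involutive c) refl

  ⊗-inverseʳ : ∀ X → det X ≡ 1ℤ → X ⊗ adj X ≡ I
  ⊗-inverseʳ (mk a b c d) det≡1 = begin
    mk a b c d ⊗ adj (mk a b c d)             ≡⟨ mk-cong (solve vs) (solve vs) (solve vs) (solve vs) ⟩
    mk (a * d - b * c) 0ℤ 0ℤ (a * d - b * c)  ≡⟨ cong (λ δ → mk δ 0ℤ 0ℤ δ) det≡1 ⟩
    I                                         ∎
    where
    vs : List ℤ
    vs = a ∷ b ∷ c ∷ d ∷ []

  ⊗-inverseˡ : ∀ X → det X ≡ 1ℤ → adj X ⊗ X ≡ I
  ⊗-inverseˡ X det≡1 = begin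
    adj X ⊗ X              ≡⟨ cong (adj X ⊗_) (adj-involutive X) ⟨
    adj X ⊗ adj (adj X)    ≡⟨ ⊗-inverseʳ (adj X) (trans (det-adj X) det≡1) ⟩
    I                      ∎

  det-companion : ∀ z → det (companion z) ≡ 1ℤ
  det-companion z = begin
    0ℤ * z - 1ℤ * -1ℤ  ≡⟨ solve (z ∷ []) ⟩
    1ℤ                 ∎

  det-conj : ∀ z B → det B ≡ 1ℤ → det (conj z B) ≡ 1ℤ
  det-conj z B det≡1 =
    det-⊗-≡1 (B ⊗ companion z) (adj B) (det-⊗-≡1 B (companion z) det≡1 (det-companion z)) (trans (det-adj B) det≡1)

  conj-formula : ∀ z a b c d → conj z (mk a b c d) ≡
    mk (- (a * c + b * d + z * b * c)) (a * a + z * a * b + b * b) (- (c * c + z * c * d + d * d)) (a * c + b * d + z * a * d)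
  conj-formula z a b c d = mk-cong (solve vs) (solve vs) (solve vs) (solve vs)
    where
    vs : List ℤ
    vs = z ∷ a ∷ b ∷ c ∷ d ∷ []

  m12-conj : ∀ z B → m12 (conj z B) ≡ form z (m11 B) (m12 B)
  m12-conj z (mk a b c d) = cong m12 (conj-formula z a b c d)

  trace-conj : ∀ z B → det B ≡ 1ℤ → m11 (conj z B) + m22 (conj z B) ≡ z
  trace-conj z (mk a b c d) det≡1 = begin
    m11 (conj z (mk a b c d)) + m22 (conj z (mk a b c d))       ≡⟨ cong (λ K → m11 K + m22 K) (conj-formula z a b c d) ⟩
    - (a * c + b * d + z * b * c) + (a * c + b * d + z * a * d) ≡⟨ solve (z ∷ a ∷ b ∷ c ∷ d ∷ []) ⟩
    z * (a * d - b * c)                                         ≡⟨ cong (z *_) det≡1 ⟩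
    z * 1ℤ                                                      ≡⟨ *-identityʳ z ⟩
    z                                                           ∎

  conj-⊗ : ∀ z X B → conj z (X ⊗ B) ≡ X ⊗ conj z B ⊗ adj X
  conj-⊗ z X B = begin
    X ⊗ B ⊗ C ⊗ adj (X ⊗ B)          ≡⟨ cong (X ⊗ B ⊗ C ⊗_) (adj-⊗ X B) ⟩
    X ⊗ B ⊗ C ⊗ (adj B ⊗ adj X)      ≡⟨ ⊗-assoc (X ⊗ B ⊗ C) (adj B) (adj X) ⟨
    X ⊗ B ⊗ C ⊗ adj B ⊗ adj X        ≡⟨ cong (λ Y → Y ⊗ adj B ⊗ adj X) (⊗-assoc X B C) ⟩
    X ⊗ (B ⊗ C) ⊗ adj B ⊗ adj X      ≡⟨ cong (_⊗ adj X) (⊗-assoc X (B ⊗ C) (adj B)) ⟩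
    X ⊗ conj z B ⊗ adj X             ∎
    where C = companion z

module HirzebruchJung where

  open Matrix
  open import Defs using (hjVal; IsHJExpansion; DualWahl; base; stepL; stepR)
  open import Data.Empty using (⊥-elim)
  open import Data.Integer using (ℤ; +_; -_; _+_; _-_; _*_; 0ℤ; 1ℤ; -1ℤ)
  open import Data.Integer.Divisibility.Signed as Signed using (divides; ∣⇒∣ᵤ)
  open import Data.Integer.Properties using (+-injective; pos-+; pos-*; *-comm)
  open import Data.Integer.Tactic.RingSolver using (solve)
  open import Data.List using (List; []; _∷_; _++_)
  open import Data.List.Relation.Unary.All using (All; []; _∷_)
  open import Data.List.Relation.Unary.All.Properties using (++⁺; ++⁻; replicate⁺)
  open import Data.Nat as ℕ using (ℕ; suc; _≤_; _<_; s≤s; z≤n)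
  open import Data.Nat.DivMod using (_%_; [m+kn]%n≡m%n; m<n⇒m%n≡m)
  open import Data.Nat.Divisibility using (∣-antisym)
  import Data.Nat.Properties as ℕ
  open import Data.Product using (∃₂; _×_; _,_; proj₁; proj₂)
  open import Relation.Binary.PropositionalEquality
    using (_≡_; _≢_; refl; sym; trans; cong; cong₂; subst; module ≡-Reasoning)

  step : ℤ → Mat
  step x = mk x -1ℤ 1ℤ 0ℤ

  chainMat : List ℕ → Mat
  chainMat [] = I
  chainMat (b ∷ bs) = step (+ b) ⊗ chainMat bs

  chainMat-++ : ∀ xs ys → chainMat (xs ++ ys) ≡ chainMat xs ⊗ chainMat ys
  chainMat-++ [] ys = sym (⊗-identityˡ (chainMat ys))
  chainMat-++ (x ∷ xs) ys = begin
    step (+ x) ⊗ chainMat (xs ++ ys)          ≡⟨ cong (step (+ x) ⊗_) (chainMat-++ xs ys) ⟩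
    step (+ x) ⊗ (chainMat xs ⊗ chainMat ys)  ≡⟨ sym (⊗-assoc (step (+ x)) (chainMat xs) (chainMat ys)) ⟩
    step (+ x) ⊗ chainMat xs ⊗ chainMat ys    ∎
    where open ≡-Reasoning

  det-step : ∀ x → det (step x) ≡ 1ℤ
  det-step x = begin
    x * 0ℤ - -1ℤ * 1ℤ  ≡⟨ solve vs ⟩
    1ℤ                 ∎
    where
    open ≡-Reasoning
    vs : List ℤ
    vs = x ∷ []

  det-chainMat : ∀ bs → det (chainMat bs) ≡ 1ℤ
  det-chainMat [] = refl
  det-chainMat (b ∷ bs) = det-⊗-≡1 (step (+ b)) (chainMat bs) (det-step (+ b)) (det-chainMat bs)

  column-step : ∀ x X → column (step x ⊗ X) ≡ (x * m11 X - m21 X , m11 X)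
  column-step x (mk a b c d) = cong column step-⊗
    where
    vs : List ℤ
    vs = x ∷ a ∷ b ∷ c ∷ d ∷ []
    step-⊗ : step x ⊗ mk a b c d ≡ mk (x * a - c) (x * b - d) a b
    step-⊗ = mk-cong (solve vs) (solve vs) (solve vs) (solve vs)

  hjVal≡column : ∀ b bs → hjVal (b ∷ bs) ≡ column (chainMat (b ∷ bs))
  hjVal≡column b [] = sym (cong column (⊗-identityʳ (step (+ b))))
  hjVal≡column b (c ∷ cs) = begin
    hjVal (b ∷ c ∷ cs)                                               ≡⟨ cong (λ (N , D) → (+ b * N - D , N)) (hjVal≡column c cs) ⟩
    (+ b * m11 (chainMat (c ∷ cs)) - m21 (chainMat (c ∷ cs)) , m11 (chainMat (c ∷ cs))) ≡⟨ column-step (+ b) (chainMat (c ∷ cs)) ⟨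
    column (chainMat (b ∷ c ∷ cs))                                   ∎
    where open ≡-Reasoning

  column-bounds : ∀ {bs} → All (2 ≤_) bs → ∃₂ λ N D → column (chainMat bs) ≡ (+ N , + D) × D < N
  column-bounds [] = 1 , 0 , refl , s≤s z≤n
  column-bounds {b ∷ bs} (2≤b@(s≤s (s≤s _)) ∷ bs≥2) with column-bounds bs≥2
  ... | N , D , N,D≡ , D<N = b ℕ.* N ℕ.∸ D , N , column≡ , N<bN-D
    where
    X : Mat
    X = chainMat bs
    D≤bN : D ≤ b ℕ.* N
    D≤bN = ℕ.≤-trans (ℕ.<⇒≤ D<N) (ℕ.m≤n*m N b)
    column≡ : column (step (+ b) ⊗ X) ≡ (+ (b ℕ.* N ℕ.∸ D) , + N)
    column≡ = begin
      column (step (+ b) ⊗ X)          ≡⟨ column-step (+ b) X ⟩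
      (+ b * m11 X - m21 X , m11 X)    ≡⟨ cong (λ (N′ , D′) → (+ b * N′ - D′ , N′)) N,D≡ ⟩
      (+ b * + N - + D , + N)          ≡⟨ cong (λ x → (x - + D , + N)) (sym (pos-* b N)) ⟩
      (+ (b ℕ.* N) - + D , + N)        ≡⟨ cong (_, + N) (+m-+n≡+[m∸n] D≤bN) ⟩
      (+ (b ℕ.* N ℕ.∸ D) , + N)        ∎
      where open ≡-Reasoning
    N<bN-D : N < b ℕ.* N ℕ.∸ D
    N<bN-D = ℕ.m+n≤o⇒m≤o∸n (suc N) (begin
      suc N ℕ.+ D   ≡⟨ ℕ.+-suc N D ⟨
      N ℕ.+ suc D   ≤⟨ ℕ.+-monoʳ-≤ N D<N ⟩
      N ℕ.+ N       ≡⟨ cong (N ℕ.+_) (ℕ.+-identityʳ N) ⟨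
      2 ℕ.* N       ≤⟨ ℕ.*-monoˡ-≤ N 2≤b ⟩
      b ℕ.* N       ∎)
      where open ℕ.≤-Reasoning

  division-unique : ∀ {b₁ b₂ n d₁ d₂} → d₁ < n → d₂ < n →
                    + b₁ * + n - + d₁ ≡ + b₂ * + n - + d₂ → b₁ ≡ b₂ × d₁ ≡ d₂
  division-unique {b₁} {b₂} {n} {d₁} {d₂} d₁<n@(s≤s _) d₂<n eq = b₁≡b₂ , d₁≡d₂
    where
    open ≡-Reasoning
    swap : ∀ x y p q → x - p ≡ y - q → q + x ≡ p + y
    swap x y p q x-p≡y-q = begin
      q + x              ≡⟨ solve vs ⟩
      (x - p) + (p + q)  ≡⟨ cong (λ w → w + (p + q)) x-p≡y-q ⟩
      (y - q) + (p + q)  ≡⟨ solve vs ⟩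
      p + y              ∎
      where
      vs : List ℤ
      vs = x ∷ y ∷ p ∷ q ∷ []
    cast : ∀ d b → + (d ℕ.+ b ℕ.* n) ≡ + d + + b * + n
    cast d b = trans (pos-+ d (b ℕ.* n)) (cong (_+_ (+ d)) (pos-* b n))
    ℕ-eq : d₂ ℕ.+ b₁ ℕ.* n ≡ d₁ ℕ.+ b₂ ℕ.* n
    ℕ-eq = +-injective (begin
      + (d₂ ℕ.+ b₁ ℕ.* n)   ≡⟨ cast d₂ b₁ ⟩
      + d₂ + + b₁ * + n     ≡⟨ swap (+ b₁ * + n) (+ b₂ * + n) (+ d₁) (+ d₂) eq ⟩
      + d₁ + + b₂ * + n     ≡⟨ cast d₁ b₂ ⟨
      + (d₁ ℕ.+ b₂ ℕ.* n)   ∎)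
    d₁≡d₂ : d₁ ≡ d₂
    d₁≡d₂ = begin
      d₁                       ≡⟨ m<n⇒m%n≡m d₁<n ⟨
      d₁ % n                   ≡⟨ [m+kn]%n≡m%n d₁ b₂ n ⟨
      (d₁ ℕ.+ b₂ ℕ.* n) % n    ≡⟨ cong (_% n) ℕ-eq ⟨
      (d₂ ℕ.+ b₁ ℕ.* n) % n    ≡⟨ [m+kn]%n≡m%n d₂ b₁ n ⟩
      d₂ % n                   ≡⟨ m<n⇒m%n≡m d₂<n ⟩
      d₂                       ∎
    b₁≡b₂ : b₁ ≡ b₂
    b₁≡b₂ = ℕ.*-cancelʳ-≡ b₁ b₂ n (ℕ.+-cancelˡ-≡ d₁ _ _ (subst (λ d → d ℕ.+ b₁ ℕ.* n ≡ _) (sym d₁≡d₂) ℕ-eq))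

  m11-chainMat-nonzero : ∀ {bs} → All (2 ≤_) bs → 0ℤ ≢ m11 (chainMat bs)
  m11-chainMat-nonzero bs≥2 0≡m11 with column-bounds bs≥2
  ... | suc _ , _ , N,D≡ , _ with () ← trans 0≡m11 (cong proj₁ N,D≡)

  chainMat-injective : ∀ {xs ys} → All (2 ≤_) xs → All (2 ≤_) ys →
                       column (chainMat xs) ≡ column (chainMat ys) → xs ≡ ys
  chainMat-injective [] [] _ = refl
  chainMat-injective {ys = c ∷ cs} [] (_ ∷ cs≥2) eq =
    ⊥-elim (m11-chainMat-nonzero cs≥2 (trans (cong proj₂ eq) (cong proj₂ (column-step (+ c) (chainMat cs)))))
  chainMat-injective {xs = b ∷ bs} (_ ∷ bs≥2) [] eq =
    ⊥-elim (m11-chainMat-nonzero bs≥2 (trans (cong proj₂ (sym eq)) (cong proj₂ (column-step (+ b) (chainMat bs)))))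
  chainMat-injective {b ∷ bs} {c ∷ cs} (_ ∷ bs≥2) (_ ∷ cs≥2) eq = heads (column-bounds bs≥2) (column-bounds cs≥2)
    where
    X Y : Mat
    X = chainMat bs
    Y = chainMat cs
    steps : ∀ {N D N′ D′} → column X ≡ (+ N , + D) → column Y ≡ (+ N′ , + D′) →
            (+ b * + N - + D , + N) ≡ (+ c * + N′ - + D′ , + N′)
    steps {N} {D} {N′} {D′} X≡ Y≡ = begin
      (+ b * + N - + D , + N)        ≡⟨ cong (λ (n , d) → (+ b * n - d , n)) X≡ ⟨
      (+ b * m11 X - m21 X , m11 X)  ≡⟨ column-step (+ b) X ⟨
      column (step (+ b) ⊗ X)        ≡⟨ eq ⟩
      column (step (+ c) ⊗ Y)        ≡⟨ column-step (+ c) Y ⟩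
      (+ c * m11 Y - m21 Y , m11 Y)  ≡⟨ cong (λ (n , d) → (+ c * n - d , n)) Y≡ ⟩
      (+ c * + N′ - + D′ , + N′)     ∎
      where open ≡-Reasoning
    heads : (∃₂ λ N D → column X ≡ (+ N , + D) × D < N) → (∃₂ λ N D → column Y ≡ (+ N , + D) × D < N) →
            b ∷ bs ≡ c ∷ cs
    heads (N , D , X≡ , D<N) (N′ , D′ , Y≡ , D′<N′)
      with refl ← +-injective (cong proj₂ (steps X≡ Y≡))
      with refl , refl ← division-unique {b} {c} D<N D′<N′ (cong proj₁ (steps X≡ Y≡))
      = cong (b ∷_) (chainMat-injective bs≥2 cs≥2 (trans X≡ (sym Y≡)))

  DualWahl⇒All≥2 : ∀ {k bs} → DualWahl k bs → All (2 ≤_) bs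
  DualWahl⇒All≥2 {k} base = replicate⁺ (suc k) ℕ.≤-refl
  DualWahl⇒All≥2 (stepL w) with DualWahl⇒All≥2 w
  ... | 2≤b ∷ bs≥2 = ℕ.m≤n⇒m≤1+n 2≤b ∷ ++⁺ bs≥2 (ℕ.≤-refl ∷ [])
  DualWahl⇒All≥2 (stepR {bs = bs} w) with ++⁻ bs (DualWahl⇒All≥2 w)
  ... | bs≥2 , 2≤b ∷ [] = ℕ.≤-refl ∷ ++⁺ bs≥2 (ℕ.m≤n⇒m≤1+n 2≤b ∷ [])

  column-divides : ∀ X {N D} x y → det X ≡ 1ℤ → column X ≡ (N , D) → N * y ≡ D * x → N Signed.∣ x
  column-divides X@(mk a b c d) x y det≡1 refl ay≡cx = divides (x * d - b * y) (begin
    x                                                ≡⟨ x+e*[d-1]≡x x x (det X) det≡1 ⟨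
    x + x * (a * d - b * c - 1ℤ)                     ≡⟨ solve vs ⟩
    (x * d - b * y) * a + b * (a * y - c * x)        ≡⟨ cong (λ w → (x * d - b * y) * a + b * (w - c * x)) ay≡cx ⟩
    (x * d - b * y) * a + b * (c * x - c * x)        ≡⟨ solve vs ⟩
    (x * d - b * y) * a                              ∎)
    where
    open ≡-Reasoning
    vs : List ℤ
    vs = a ∷ b ∷ c ∷ d ∷ x ∷ y ∷ []

  hj-expansion-unique : ∀ {bs c n d} → IsHJExpansion bs n d → All (2 ≤_) c →
                        column (chainMat c) ≡ (+ n , + d) → bs ≡ c
  hj-expansion-unique {[]} (() , _)
  hj-expansion-unique {b ∷ bs} {c} {n} {d} (_ , bs≥2 , value) c≥2 column-c with column-bounds bs≥2
  ... | N@(suc _) , D , column-bs , D<N = chainMat-injective bs≥2 c≥2 (begin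
    column (chainMat (b ∷ bs))    ≡⟨ column-bs ⟩
    (+ N , + D)                   ≡⟨ cong₂ (λ N D → (+ N , + D)) N≡n D≡d ⟩
    (+ n , + d)                   ≡⟨ column-c ⟨
    column (chainMat c)           ∎)
    where
    open ≡-Reasoning
    cross : + N * + d ≡ + D * + n
    cross = subst (λ (N′ , D′) → N′ * + d ≡ D′ * + n) (trans (hjVal≡column b bs) column-bs) value
    cross′ : + n * + D ≡ + d * + N
    cross′ = trans (*-comm (+ n) (+ D)) (trans (sym cross) (*-comm (+ N) (+ d)))
    N≡n : N ≡ n
    N≡n = ∣-antisym (∣⇒∣ᵤ (column-divides (chainMat (b ∷ bs)) (+ n) (+ d) (det-chainMat (b ∷ bs)) column-bs cross))
                    (∣⇒∣ᵤ (column-divides (chainMat c) (+ N) (+ D) (det-chainMat c) column-c cross′))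
    D≡d : D ≡ d
    D≡d = ℕ.*-cancelʳ-≡ D d N (+-injective (begin
      + (D ℕ.* N)     ≡⟨ pos-* D N ⟩
      + D * + N       ≡⟨ cong (λ m → + D * + m) N≡n ⟩
      + D * + n       ≡⟨ cross ⟨
      + N * + d       ≡⟨ *-comm (+ N) (+ d) ⟩
      + d * + N       ≡⟨ pos-* d N ⟨
      + (d ℕ.* N)     ∎))

module SternBrocot where

  open Matrix
  open import Defs using (Dir; L; R; Path)
  open import Data.Integer using (ℤ; +_; -_; _+_; _-_; _*_; 1ℤ; ∣_∣)
  open import Data.Integer.Properties using (pos-+; abs-*)
  open import Data.Integer.Tactic.RingSolver using (solve)
  open import Data.List using (List; []; _∷_; _++_; [_])
  open import Data.Nat as ℕ using (_<_)
  open import Data.Nat.Induction using (<-wellFounded)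
  import Data.Nat.Properties as ℕ
  open import Data.Product using (∃; _,_)
  open import Induction.WellFounded using (Acc; acc)
  open import Relation.Binary using (tri<; tri≈; tri>)
  open import Relation.Binary.PropositionalEquality using (_≡_; refl; sym; trans; cong; subst; module ≡-Reasoning)
  open ≡-Reasoning

  sternBrocot : Dir → Mat
  sternBrocot L = lower
  sternBrocot R = upper

  word : Path → Mat
  word [] = I
  word (d ∷ p) = sternBrocot d ⊗ word p

  word-∷ʳ : ∀ p d → word (p ++ [ d ]) ≡ word p ⊗ sternBrocot d
  word-∷ʳ [] d = trans (⊗-identityʳ (sternBrocot d)) (sym (⊗-identityˡ (sternBrocot d)))
  word-∷ʳ (d′ ∷ p) d = begin
    sternBrocot d′ ⊗ word (p ++ [ d ])         ≡⟨ cong (sternBrocot d′ ⊗_) (word-∷ʳ p d) ⟩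
    sternBrocot d′ ⊗ (word p ⊗ sternBrocot d)  ≡⟨ ⊗-assoc (sternBrocot d′) (word p) (sternBrocot d) ⟨
    sternBrocot d′ ⊗ word p ⊗ sternBrocot d    ∎

  det-word : ∀ p → det (word p) ≡ 1ℤ
  det-word [] = refl
  det-word (L ∷ p) = det-⊗-≡1 lower (word p) refl (det-word p)
  det-word (R ∷ p) = det-⊗-≡1 upper (word p) refl (det-word p)

  row-⊗-upper : ∀ X → row (X ⊗ upper) ≡ (m11 X , m11 X + m12 X)
  row-⊗-upper (mk a b c d) = cong row product
    where
    vs : List ℤ
    vs = a ∷ b ∷ c ∷ d ∷ []
    product : mk a b c d ⊗ upper ≡ mk a (a + b) c (c + d)
    product = mk-cong (solve vs) (solve vs) (solve vs) (solve vs)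

  row-⊗-lower : ∀ X → row (X ⊗ lower) ≡ (m11 X + m12 X , m12 X)
  row-⊗-lower (mk a b c d) = cong row product
    where
    vs : List ℤ
    vs = a ∷ b ∷ c ∷ d ∷ []
    product : mk a b c d ⊗ lower ≡ mk (a + b) b (c + d) d
    product = mk-cong (solve vs) (solve vs) (solve vs) (solve vs)

  row-⊗-adj-upper : ∀ X → row (X ⊗ adj upper) ≡ (m11 X , m12 X - m11 X)
  row-⊗-adj-upper (mk a b c d) = cong row product
    where
    vs : List ℤ
    vs = a ∷ b ∷ c ∷ d ∷ []
    product : mk a b c d ⊗ adj upper ≡ mk a (b - a) c (d - c)
    product = mk-cong (solve vs) (solve vs) (solve vs) (solve vs)

  row-⊗-adj-lower : ∀ X → row (X ⊗ adj lower) ≡ (m11 X - m12 X , m12 X)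
  row-⊗-adj-lower (mk a b c d) = cong row product
    where
    vs : List ℤ
    vs = a ∷ b ∷ c ∷ d ∷ []
    product : mk a b c d ⊗ adj lower ≡ mk (a - b) b (c - d) d
    product = mk-cong (solve vs) (solve vs) (solve vs) (solve vs)

  word-snoc-row : ∀ p d → row (upper ⊗ word (p ++ [ d ])) ≡ row (upper ⊗ word p ⊗ sternBrocot d)
  word-snoc-row p d = cong row (trans (cong (upper ⊗_) (word-∷ʳ p d)) (sym (⊗-assoc upper (word p) (sternBrocot d))))

  diagonal-unit : ∀ {x} B → det B ≡ 1ℤ → row B ≡ (+ x , + x) → x ≡ 1
  diagonal-unit {x} (mk a b c d) det≡1 refl = ℕ.m*n≡1⇒m≡1 x ∣ d - c ∣ (begin
    x ℕ.* ∣ d - c ∣     ≡⟨ abs-* (+ x) (d - c) ⟨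
    ∣ + x * (d - c) ∣   ≡⟨ cong ∣_∣ (factor (+ x) c d) ⟨
    ∣ + x * d - + x * c ∣ ≡⟨ cong ∣_∣ det≡1 ⟩
    1                   ∎)
    where
    factor : ∀ a c d → a * d - a * c ≡ a * (d - c)
    factor a c d = solve (a ∷ c ∷ d ∷ [])

  stern-brocot : ∀ {x y} B → det B ≡ 1ℤ → row B ≡ (+ x , + y) → 0 < x → 0 < y →
                 ∃ λ p → row (upper ⊗ word p) ≡ (+ x , + y)
  stern-brocot B = descend B (<-wellFounded _)
    where
    descend : ∀ {x y} B → Acc _<_ (x ℕ.+ y) → det B ≡ 1ℤ → row B ≡ (+ x , + y) → 0 < x → 0 < y →
              ∃ λ p → row (upper ⊗ word p) ≡ (+ x , + y)
    descend {x} {y} B (acc smaller) det≡1 row≡ 0<x 0<y with ℕ.<-cmp x y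
    ... | tri≈ _ refl _ rewrite diagonal-unit B det≡1 row≡ = [] , refl
    ... | tri< x<y _ _ with descend (B ⊗ adj upper) (smaller shorter) (det-⊗-≡1 B (adj upper) det≡1 refl) row′ 0<x (ℕ.m<n⇒0<n∸m x<y)
      where
      shorter : x ℕ.+ (y ℕ.∸ x) < x ℕ.+ y
      shorter = subst (_< x ℕ.+ y) (sym (ℕ.m+[n∸m]≡n (ℕ.<⇒≤ x<y))) (ℕ.m<n+m y 0<x)
      row′ : row (B ⊗ adj upper) ≡ (+ x , + (y ℕ.∸ x))
      row′ = begin
        row (B ⊗ adj upper)      ≡⟨ row-⊗-adj-upper B ⟩
        (m11 B , m12 B - m11 B)  ≡⟨ cong (λ (a , b) → (a , b - a)) row≡ ⟩
        (+ x , + y - + x)        ≡⟨ cong (+ x ,_) (+m-+n≡+[m∸n] (ℕ.<⇒≤ x<y)) ⟩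
        (+ x , + (y ℕ.∸ x))      ∎
    ... | p , row-p = p ++ [ R ] , (begin
        row (upper ⊗ word (p ++ [ R ]))              ≡⟨ word-snoc-row p R ⟩
        row (upper ⊗ word p ⊗ upper)                 ≡⟨ row-⊗-upper (upper ⊗ word p) ⟩
        (m11 W , m11 W + m12 W)                      ≡⟨ cong (λ (a , b) → (a , a + b)) row-p ⟩
        (+ x , + x + + (y ℕ.∸ x))                    ≡⟨ cong (+ x ,_) (sym (pos-+ x (y ℕ.∸ x))) ⟩
        (+ x , + (x ℕ.+ (y ℕ.∸ x)))                  ≡⟨ cong (λ n → + x , + n) (ℕ.m+[n∸m]≡n (ℕ.<⇒≤ x<y)) ⟩
        (+ x , + y)                                  ∎)
      where
      W : Mat
      W = upper ⊗ word p
    descend {x} {y} B (acc smaller) det≡1 row≡ 0<x 0<y | tri> _ _ y<x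
      with descend (B ⊗ adj lower) (smaller shorter) (det-⊗-≡1 B (adj lower) det≡1 refl) row′ (ℕ.m<n⇒0<n∸m y<x) 0<y
      where
      shorter : (x ℕ.∸ y) ℕ.+ y < x ℕ.+ y
      shorter = subst (_< x ℕ.+ y) (sym (ℕ.m∸n+n≡m (ℕ.<⇒≤ y<x))) (ℕ.m<m+n x 0<y)
      row′ : row (B ⊗ adj lower) ≡ (+ (x ℕ.∸ y) , + y)
      row′ = begin
        row (B ⊗ adj lower)      ≡⟨ row-⊗-adj-lower B ⟩
        (m11 B - m12 B , m12 B)  ≡⟨ cong (λ (a , b) → (a - b , b)) row≡ ⟩
        (+ x - + y , + y)        ≡⟨ cong (_, + y) (+m-+n≡+[m∸n] (ℕ.<⇒≤ y<x)) ⟩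
        (+ (x ℕ.∸ y) , + y)      ∎
    ... | p , row-p = p ++ [ L ] , (begin
        row (upper ⊗ word (p ++ [ L ]))              ≡⟨ word-snoc-row p L ⟩
        row (upper ⊗ word p ⊗ lower)                 ≡⟨ row-⊗-lower (upper ⊗ word p) ⟩
        (m11 W + m12 W , m12 W)                      ≡⟨ cong (λ (a , b) → (a + b , b)) row-p ⟩
        (+ (x ℕ.∸ y) + + y , + y)                    ≡⟨ cong (_, + y) (sym (pos-+ (x ℕ.∸ y) y)) ⟩
        (+ ((x ℕ.∸ y) ℕ.+ y) , + y)                  ≡⟨ cong (λ n → + n , + y) (ℕ.m∸n+n≡m (ℕ.<⇒≤ y<x)) ⟩
        (+ x , + y)                                  ∎)
      where
      W : Mat
      W = upper ⊗ word p

module DualWahlChains where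

  open Matrix
  open HirzebruchJung
  open SternBrocot using (word)
  open import Defs using (L; R; DualWahl; base; stepL; stepR)
  open import Data.Integer using (ℤ; +_; -_; _+_; _-_; 0ℤ; 1ℤ; -1ℤ)
  open import Data.Integer.Tactic.RingSolver using (solve)
  open import Data.List using (List; []; _∷_; _++_; [_]; replicate; initLast; _∷ʳ′_)
  open import Data.Nat as ℕ using (ℕ; suc; zero)
  open import Data.Product using (∃; _×_; _,_)
  open import Relation.Binary.PropositionalEquality using (_≡_; refl; sym; trans; cong; module ≡-Reasoning)
  open ≡-Reasoning

  G : Mat
  G = mk -1ℤ 1ℤ -1ℤ 0ℤ

  Realises : ℕ → List ℕ → Mat → Set
  Realises k c B = chainMat c ⊗ G ≡ conj (+ k) B

  column-realised : ∀ {k c B} → Realises k c B →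
                    column (chainMat c) ≡ (m12 (conj (+ k) B) , m22 (conj (+ k) B))
  column-realised {c = c} realises = trans (column-via-G (chainMat c)) (cong (λ Y → m12 Y , m22 Y) realises)
    where
    column-via-G : ∀ X → column X ≡ (m12 (X ⊗ G) , m22 (X ⊗ G))
    column-via-G (mk a b c d) = cong (λ Y → m12 Y , m22 Y) (sym ⊗-G)
      where
      vs : List ℤ
      vs = a ∷ b ∷ c ∷ d ∷ []
      ⊗-G : mk a b c d ⊗ G ≡ mk (- a - b) a (- c - d) c
      ⊗-G = mk-cong (solve vs) (solve vs) (solve vs) (solve vs)

  realises-base : ∀ k → Realises k (replicate (suc k) 2) upper
  realises-base k = begin
    chainMat (replicate (suc k) 2) ⊗ G  ≡⟨ cong (_⊗ G) (twos (suc k)) ⟩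
    twos-closed (1ℤ + + k) ⊗ G          ≡⟨ closed (+ k) ⟩
    conj (+ k) upper                    ∎
    where
    twos-closed : ℤ → Mat
    twos-closed n = mk (n + 1ℤ) (- n) n (1ℤ - n)
    twos-step : ∀ n → step (+ 2) ⊗ twos-closed n ≡ twos-closed (1ℤ + n)
    twos-step n = mk-cong (solve (n ∷ [])) (solve (n ∷ [])) (solve (n ∷ [])) (solve (n ∷ []))
    twos : ∀ n → chainMat (replicate n 2) ≡ twos-closed (+ n)
    twos zero = refl
    twos (suc n) = trans (cong (step (+ 2) ⊗_) (twos n)) (twos-step (+ n))
    closed : ∀ z → twos-closed (1ℤ + z) ⊗ G ≡ conj z upper
    closed z = mk-cong (solve (z ∷ [])) (solve (z ∷ [])) (solve (z ∷ [])) (solve (z ∷ []))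

  upper-⊗-step : ∀ x → upper ⊗ step x ≡ step (1ℤ + x)
  upper-⊗-step x = mk-cong (solve (x ∷ [])) (solve (x ∷ [])) (solve (x ∷ [])) (solve (x ∷ []))

  step-⊗-adj-lower : ∀ x → step x ⊗ adj lower ≡ step (1ℤ + x)
  step-⊗-adj-lower x = mk-cong (solve (x ∷ [])) (solve (x ∷ [])) (solve (x ∷ [])) (solve (x ∷ []))

  step-2-⊗-G : step (+ 2) ⊗ G ≡ G ⊗ adj upper
  step-2-⊗-G = refl

  adj-lower-⊗-G : adj lower ⊗ G ≡ G ⊗ adj (step (+ 2))
  adj-lower-⊗-G = refl

  upper-⊗-lower : upper ⊗ lower ≡ step (+ 2) ⊗ upper
  upper-⊗-lower = refl

  chainMat-∷ʳ : ∀ bs b → chainMat (bs ++ [ b ]) ≡ chainMat bs ⊗ step (+ b)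
  chainMat-∷ʳ bs b = trans (chainMat-++ bs [ b ]) (cong (chainMat bs ⊗_) (⊗-identityʳ (step (+ b))))

  realises-stepL : ∀ {k b bs B} → Realises k (b ∷ bs) B → Realises k (suc b ∷ bs ++ [ 2 ]) (upper ⊗ B)
  realises-stepL {k} {b} {bs} {B} realises = begin
    step (1ℤ + + b) ⊗ chainMat (bs ++ [ 2 ]) ⊗ G          ≡⟨ cong (λ Y → step (1ℤ + + b) ⊗ Y ⊗ G) (chainMat-∷ʳ bs 2) ⟩
    step (1ℤ + + b) ⊗ (X ⊗ step (+ 2)) ⊗ G                ≡⟨ cong (λ Y → Y ⊗ (X ⊗ step (+ 2)) ⊗ G) (upper-⊗-step (+ b)) ⟨
    upper ⊗ step (+ b) ⊗ (X ⊗ step (+ 2)) ⊗ G             ≡⟨ cong (_⊗ G) (⊗-assoc (upper ⊗ step (+ b)) X (step (+ 2))) ⟨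
    upper ⊗ step (+ b) ⊗ X ⊗ step (+ 2) ⊗ G               ≡⟨ ⊗-assoc (upper ⊗ step (+ b) ⊗ X) (step (+ 2)) G ⟩
    upper ⊗ step (+ b) ⊗ X ⊗ (step (+ 2) ⊗ G)             ≡⟨ cong (upper ⊗ step (+ b) ⊗ X ⊗_) step-2-⊗-G ⟩
    upper ⊗ step (+ b) ⊗ X ⊗ (G ⊗ adj upper)              ≡⟨ ⊗-assoc (upper ⊗ step (+ b) ⊗ X) G (adj upper) ⟨
    upper ⊗ step (+ b) ⊗ X ⊗ G ⊗ adj upper                ≡⟨ cong (λ Y → Y ⊗ G ⊗ adj upper) (⊗-assoc upper (step (+ b)) X) ⟩
    upper ⊗ (step (+ b) ⊗ X) ⊗ G ⊗ adj upper              ≡⟨ cong (_⊗ adj upper) (⊗-assoc upper (step (+ b) ⊗ X) G) ⟩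
    upper ⊗ (chainMat (b ∷ bs) ⊗ G) ⊗ adj upper           ≡⟨ cong (λ Y → upper ⊗ Y ⊗ adj upper) realises ⟩
    upper ⊗ conj (+ k) B ⊗ adj upper                      ≡⟨ conj-⊗ (+ k) upper B ⟨
    conj (+ k) (upper ⊗ B)                                ∎
    where
    X : Mat
    X = chainMat bs

  realises-stepR : ∀ {k b bs B} → Realises k (bs ++ [ b ]) B →
                   Realises k (2 ∷ bs ++ [ suc b ]) (step (+ 2) ⊗ B)
  realises-stepR {k} {b} {bs} {B} realises = begin
    S ⊗ chainMat (bs ++ [ suc b ]) ⊗ G          ≡⟨ cong (λ Y → S ⊗ Y ⊗ G) (chainMat-∷ʳ bs (suc b)) ⟩
    S ⊗ (X ⊗ step (1ℤ + + b)) ⊗ G               ≡⟨ cong (λ Y → S ⊗ (X ⊗ Y) ⊗ G) (step-⊗-adj-lower (+ b)) ⟨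
    S ⊗ (X ⊗ (step (+ b) ⊗ adj lower)) ⊗ G      ≡⟨ cong (λ Y → S ⊗ Y ⊗ G) (⊗-assoc X (step (+ b)) (adj lower)) ⟨
    S ⊗ (Y ⊗ adj lower) ⊗ G                     ≡⟨ ⊗-assoc S (Y ⊗ adj lower) G ⟩
    S ⊗ (Y ⊗ adj lower ⊗ G)                     ≡⟨ cong (S ⊗_) (⊗-assoc Y (adj lower) G) ⟩
    S ⊗ (Y ⊗ (adj lower ⊗ G))                   ≡⟨ cong (λ Z → S ⊗ (Y ⊗ Z)) adj-lower-⊗-G ⟩
    S ⊗ (Y ⊗ (G ⊗ adj S))                       ≡⟨ cong (S ⊗_) (⊗-assoc Y G (adj S)) ⟨
    S ⊗ (Y ⊗ G ⊗ adj S)                         ≡⟨ ⊗-assoc S (Y ⊗ G) (adj S) ⟨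
    S ⊗ (Y ⊗ G) ⊗ adj S                         ≡⟨ cong (λ Z → S ⊗ (Z ⊗ G) ⊗ adj S) (chainMat-∷ʳ bs b) ⟨
    S ⊗ (chainMat (bs ++ [ b ]) ⊗ G) ⊗ adj S    ≡⟨ cong (λ Z → S ⊗ Z ⊗ adj S) realises ⟩
    S ⊗ conj (+ k) B ⊗ adj S                    ≡⟨ conj-⊗ (+ k) S B ⟨
    conj (+ k) (S ⊗ B)                          ∎
    where
    S X Y : Mat
    S = step (+ 2)
    X = chainMat bs
    Y = X ⊗ step (+ b)

  -- Since upper ⊗ lower ≡ step 2 ⊗ upper, prepending lower (resp. upper) to a word
  -- is the Wahl move stepR (resp. stepL) on the realising chain.
  wahl-word : ∀ k p → ∃ λ c → DualWahl k c × Realises k c (upper ⊗ word p)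
  wahl-word k [] = replicate (suc k) 2 , base , trans (realises-base k) (cong (conj (+ k)) (sym (⊗-identityʳ upper)))
  wahl-word k (R ∷ p) with wahl-word k p
  ... | [] , () , _
  ... | b ∷ bs , wahl , realises = _ , stepL wahl , realises-stepL {b = b} {bs} {upper ⊗ word p} realises
  wahl-word k (L ∷ p) with wahl-word k p
  ... | c , wahl , realises with initLast c
  ...   | [] with () ← wahl
  ...   | bs ∷ʳ′ b = _ , stepR wahl , trans (realises-stepR {b = b} {bs} {upper ⊗ word p} realises) (cong (conj (+ k)) upper-lower)
    where
    upper-lower : step (+ 2) ⊗ (upper ⊗ word p) ≡ upper ⊗ (lower ⊗ word p)
    upper-lower = begin
      step (+ 2) ⊗ (upper ⊗ word p)  ≡⟨ ⊗-assoc (step (+ 2)) upper (word p) ⟨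
      step (+ 2) ⊗ upper ⊗ word p    ≡⟨ cong (_⊗ word p) upper-⊗-lower ⟨
      upper ⊗ lower ⊗ word p         ≡⟨ ⊗-assoc upper lower (word p) ⟩
      upper ⊗ (lower ⊗ word p)       ∎

module Reduction where

  open Matrix
  open import Data.Empty using (⊥; ⊥-elim)
  open import Data.Integer using (ℤ; +_; -[1+_]; +0; +[1+_]; -_; _+_; _-_; _*_; 0ℤ; 1ℤ; -1ℤ; ∣_∣; _⊖_)
  open import Data.Integer.Properties
    using (+-injective; pos-+; pos-*; abs-*; *-identityʳ; neg-involutive; neg-distribʳ-*; m-n≡m⊖n; ⊖-≥; ⊖-<; n⊖n≡0)
  open import Data.Integer.Tactic.RingSolver using (solve)
  open import Data.List using (List; _∷_; [])
  open import Data.Nat as ℕ using (ℕ; suc; _≤_; _<_; s≤s; z≤n)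
  open import Data.Nat.Induction using (<-wellFounded)
  import Data.Nat.Properties as ℕ
  import Data.Nat.Tactic.RingSolver as ℕ-RingSolver
  open import Data.Product using (∃₂; _×_; _,_; proj₁; proj₂)
  open import Data.Sum using (_⊎_; inj₁; inj₂)
  open import Induction.WellFounded using (Acc; acc)
  open import Relation.Binary using (Tri; tri<; tri≈; tri>)
  open import Relation.Binary.PropositionalEquality
    using (_≡_; _≢_; refl; sym; trans; cong; cong₂; subst; module ≡-Reasoning)

  minus-one : Mat
  minus-one = mk -1ℤ 0ℤ 0ℤ -1ℤ

  negate : Mat → Mat
  negate B = B ⊗ minus-one

  PositiveRow : Mat → Set
  PositiveRow B = ∃₂ λ x y → row B ≡ (+ x , + y) × 0 < x × 0 < y

  record Normal (z : ℤ) (B : Mat) : Set where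
    constructor normal
    field
      {representative} : Mat
      det≡1            : det representative ≡ 1ℤ
      same-conj        : conj z representative ≡ conj z B
      positive         : PositiveRow representative

  Normal-cong : ∀ {z B₁ B₂} → conj z B₁ ≡ conj z B₂ → Normal z B₁ → Normal z B₂
  Normal-cong eq (normal det≡1 conj≡ positive) = normal det≡1 (trans conj≡ eq) positive

  conj-⊗-commuting : ∀ z B S → det S ≡ 1ℤ → S ⊗ companion z ≡ companion z ⊗ S → conj z (B ⊗ S) ≡ conj z B
  conj-⊗-commuting z B S det≡1 commutes = begin
    B ⊗ S ⊗ C ⊗ adj (B ⊗ S)          ≡⟨ cong (B ⊗ S ⊗ C ⊗_) (adj-⊗ B S) ⟩
    B ⊗ S ⊗ C ⊗ (adj S ⊗ adj B)      ≡⟨ ⊗-assoc (B ⊗ S ⊗ C) (adj S) (adj B) ⟨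
    B ⊗ S ⊗ C ⊗ adj S ⊗ adj B        ≡⟨ cong (λ Y → Y ⊗ adj S ⊗ adj B) (⊗-assoc B S C) ⟩
    B ⊗ (S ⊗ C) ⊗ adj S ⊗ adj B      ≡⟨ cong (λ Y → B ⊗ Y ⊗ adj S ⊗ adj B) commutes ⟩
    B ⊗ (C ⊗ S) ⊗ adj S ⊗ adj B      ≡⟨ cong (λ Y → Y ⊗ adj S ⊗ adj B) (⊗-assoc B C S) ⟨
    B ⊗ C ⊗ S ⊗ adj S ⊗ adj B        ≡⟨ cong (_⊗ adj B) (⊗-assoc (B ⊗ C) S (adj S)) ⟩
    B ⊗ C ⊗ (S ⊗ adj S) ⊗ adj B      ≡⟨ cong (λ Y → B ⊗ C ⊗ Y ⊗ adj B) (⊗-inverseʳ S det≡1) ⟩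
    B ⊗ C ⊗ I ⊗ adj B                ≡⟨ cong (_⊗ adj B) (⊗-identityʳ (B ⊗ C)) ⟩
    B ⊗ C ⊗ adj B                    ∎
    where
    open ≡-Reasoning
    C : Mat
    C = companion z

  conj-⊗-companion : ∀ z B → conj z (B ⊗ companion z) ≡ conj z B
  conj-⊗-companion z B = conj-⊗-commuting z B (companion z) (det-companion z) refl

  conj-⊗-adj-companion : ∀ z B → conj z (B ⊗ adj (companion z)) ≡ conj z B
  conj-⊗-adj-companion z B = conj-⊗-commuting z B (adj C) (trans (det-adj C) (det-companion z))
    (trans (⊗-inverseˡ C (det-companion z)) (sym (⊗-inverseʳ C (det-companion z))))
    where C = companion z

  conj-negate : ∀ z B → conj z (negate B) ≡ conj z B
  conj-negate z B = conj-⊗-commuting z B minus-one refl (mk-cong (solve vs) (solve vs) (solve vs) (solve vs))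
    where
    vs : List ℤ
    vs = z ∷ []

  det-negate : ∀ B → det (negate B) ≡ det B
  det-negate B = trans (det-⊗ B minus-one) (*-identityʳ (det B))

  row-negate : ∀ B → row (negate B) ≡ (- m11 B , - m12 B)
  row-negate (mk a b c d) = cong row product
    where
    vs : List ℤ
    vs = a ∷ b ∷ c ∷ d ∷ []
    product : mk a b c d ⊗ minus-one ≡ mk (- a) (- b) (- c) (- d)
    product = mk-cong (solve vs) (solve vs) (solve vs) (solve vs)

  row-⊗-companion : ∀ z B → row (B ⊗ companion z) ≡ (- m12 B , m11 B + z * m12 B)
  row-⊗-companion z (mk a b c d) = cong row product
    where
    vs : List ℤ
    vs = z ∷ a ∷ b ∷ c ∷ d ∷ []
    product : mk a b c d ⊗ companion z ≡ mk (- b) (a + z * b) (- d) (c + z * d)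
    product = mk-cong (solve vs) (solve vs) (solve vs) (solve vs)

  row-⊗-adj-companion : ∀ z B → row (B ⊗ adj (companion z)) ≡ (z * m11 B + m12 B , - m11 B)
  row-⊗-adj-companion z (mk a b c d) = cong row product
    where
    vs : List ℤ
    vs = z ∷ a ∷ b ∷ c ∷ d ∷ []
    product : mk a b c d ⊗ adj (companion z) ≡ mk (z * a + b) (- a) (z * c + d) (- c)
    product = mk-cong (solve vs) (solve vs) (solve vs) (solve vs)

  unit-square : ∀ x y → x * y ≡ 1ℤ → x * x ≡ 1ℤ
  unit-square x y xy≡1 with ℕ.m*n≡1⇒m≡1 ∣ x ∣ ∣ y ∣ (trans (sym (abs-* x y)) (cong ∣_∣ xy≡1))
  unit-square (+ 1) y _ | refl = refl
  unit-square -[1+ 0 ] y _ | refl = refl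

  form-unit : ∀ z B → det B ≡ 1ℤ → m11 B ≡ 0ℤ ⊎ m12 B ≡ 0ℤ → m12 (conj z B) ≡ 1ℤ
  form-unit z (mk a b c d) det≡1 (inj₁ refl) = begin
    m12 (conj z (mk 0ℤ b c d))  ≡⟨ m12-conj z (mk 0ℤ b c d) ⟩
    0ℤ * 0ℤ + z * 0ℤ * b + b * b ≡⟨ solve (z ∷ b ∷ []) ⟩
    b * b                       ≡⟨ unit-square b (- c) (begin
                                     b * - c        ≡⟨ solve (b ∷ c ∷ d ∷ []) ⟩
                                     0ℤ * d - b * c ≡⟨ det≡1 ⟩
                                     1ℤ             ∎) ⟩
    1ℤ                          ∎
    where open ≡-Reasoning
  form-unit z (mk a b c d) det≡1 (inj₂ refl) = begin
    m12 (conj z (mk a 0ℤ c d))  ≡⟨ m12-conj z (mk a 0ℤ c d) ⟩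
    a * a + z * a * 0ℤ + 0ℤ * 0ℤ ≡⟨ solve (z ∷ a ∷ []) ⟩
    a * a                       ≡⟨ unit-square a d (begin
                                     a * d          ≡⟨ solve (a ∷ c ∷ d ∷ []) ⟩
                                     a * d - 0ℤ * c ≡⟨ det≡1 ⟩
                                     1ℤ             ∎) ⟩
    1ℤ                          ∎
    where open ≡-Reasoning

  form-mixed : ∀ {k M A β} B → row B ≡ (+ A , - + β) → m12 (conj (+ k) B) ≡ + M →
               M ℕ.+ k ℕ.* A ℕ.* β ≡ A ℕ.* A ℕ.+ β ℕ.* β
  form-mixed {k} {M} {A} {β} B row≡ conj≡M = +-injective (begin
    + (M ℕ.+ k ℕ.* A ℕ.* β)                     ≡⟨ pos-+ M (k ℕ.* A ℕ.* β) ⟩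
    + M + + (k ℕ.* A ℕ.* β)                     ≡⟨ cong (_+_ (+ M)) (pos-*-* k A β) ⟩
    + M + + k * + A * + β                        ≡⟨ cong (_+ + k * + A * + β) conj≡M ⟨
    m12 (conj (+ k) B) + + k * + A * + β         ≡⟨ cong (_+ + k * + A * + β) (m12-conj (+ k) B) ⟩
    form (+ k) (m11 B) (m12 B) + + k * + A * + β ≡⟨ cong (λ (a , b) → form (+ k) a b + + k * + A * + β) row≡ ⟩
    form (+ k) (+ A) (- + β) + + k * + A * + β   ≡⟨ cancel (+ k) (+ A) (+ β) ⟩
    + A * + A + + β * + β                        ≡⟨ cong₂ _+_ (pos-* A A) (pos-* β β) ⟨
    + (A ℕ.* A) + + (β ℕ.* β)                    ≡⟨ pos-+ (A ℕ.* A) (β ℕ.* β) ⟨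
    + (A ℕ.* A ℕ.+ β ℕ.* β)                      ∎)
    where
    open ≡-Reasoning
    pos-*-* : ∀ x y w → + (x ℕ.* y ℕ.* w) ≡ + x * + y * + w
    pos-*-* x y w = trans (pos-* (x ℕ.* y) w) (cong (_* + w) (pos-* x y))
    cancel : ∀ z a b → a * a + z * a * - b + - b * - b + z * a * b ≡ a * a + b * b
    cancel z a b = solve (z ∷ a ∷ b ∷ [])

  swap-last : ∀ k b a → k ℕ.* b ℕ.* a ≡ k ℕ.* a ℕ.* b
  swap-last = ℕ-RingSolver.solve-∀

  -- Bounds the descent: a step that does not shorten the row would make the form vanish.
  form-degenerate : ∀ {M k A β} → M ℕ.+ k ℕ.* A ℕ.* β ≡ A ℕ.* A ℕ.+ β ℕ.* β → β ≤ A → 2 ℕ.* A ≤ k ℕ.* β → M ≡ 0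
  form-degenerate {M} {k} {A} {β} form≡ β≤A 2A≤kβ = ℕ.n≤0⇒n≡0 (ℕ.+-cancelʳ-≤ (k ℕ.* A ℕ.* β) M 0 (begin
    M ℕ.+ k ℕ.* A ℕ.* β      ≡⟨ form≡ ⟩
    A ℕ.* A ℕ.+ β ℕ.* β      ≤⟨ ℕ.+-monoʳ-≤ (A ℕ.* A) (ℕ.*-mono-≤ β≤A β≤A) ⟩
    A ℕ.* A ℕ.+ A ℕ.* A      ≡⟨ double A ⟩
    2 ℕ.* A ℕ.* A            ≤⟨ ℕ.*-monoˡ-≤ A 2A≤kβ ⟩
    k ℕ.* β ℕ.* A            ≡⟨ swap-last k β A ⟩
    k ℕ.* A ℕ.* β            ∎))
    where
    open ℕ.≤-Reasoning
    double : ∀ a → a ℕ.* a ℕ.+ a ℕ.* a ≡ 2 ℕ.* a ℕ.* a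
    double = ℕ-RingSolver.solve-∀

  private
    positive : ∀ {z B} → det B ≡ 1ℤ → PositiveRow B → Normal z B
    positive det≡1 pos = normal det≡1 refl pos

    no-zero : ∀ {z M} B → det B ≡ 1ℤ → m12 (conj z B) ≡ + M → 2 ≤ M → m11 B ≡ 0ℤ ⊎ m12 B ≡ 0ℤ → ⊥
    no-zero {z} B det≡1 conj≡M 2≤M has-zero =
      ℕ.<-irrefl refl (subst (1 <_) (+-injective (trans (sym conj≡M) (form-unit z B det≡1 has-zero))) 2≤M)

    nonzero : ∀ {M} → 2 ≤ M → M ≢ 0
    nonzero (s≤s _) ()

    double≤ : ∀ {a n} → a ≤ n → a ≤ n ℕ.∸ a → 2 ℕ.* a ≤ n
    double≤ {a} {n} a≤n a≤n-a = begin
      2 ℕ.* a            ≡⟨ cong (a ℕ.+_) (ℕ.+-identityʳ a) ⟩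
      a ℕ.+ a            ≤⟨ ℕ.+-monoʳ-≤ a a≤n-a ⟩
      a ℕ.+ (n ℕ.∸ a)    ≡⟨ ℕ.m+[n∸m]≡n a≤n ⟩
      n                  ∎
      where open ℕ.≤-Reasoning

  record MixedRow (k M A β : ℕ) (B : Mat) : Set where
    constructor mixed-row
    field
      det≡1 : det B ≡ 1ℤ
      m12≡M : m12 (conj (+ k) B) ≡ + M
      row≡  : row B ≡ (+ A , - + β)
      0<A   : 0 < A
      0<β   : 0 < β

  Below : ℕ → ℕ → ℕ → Set
  Below k M n = ∀ {A β} B → A ℕ.+ β < n → MixedRow k M A β B → Normal (+ k) B

  step-companion : ∀ {k M A β B} → 2 ≤ M → β ≤ A → MixedRow k M A β B → Below k M (A ℕ.+ β) →
                   Normal (+ k) (B ⊗ companion (+ k))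
  step-companion {k} {M} {A} {β} {B} 2≤M β≤A (mixed-row det≡1 m12≡M row≡ 0<A 0<β) recurse = turn (ℕ.<-cmp (k ℕ.* β) A)
    where
    open ≡-Reasoning
    z : ℤ
    z = + k
    B′ : Mat
    B′ = B ⊗ companion z
    det′ : det B′ ≡ 1ℤ
    det′ = det-⊗-≡1 B (companion z) det≡1 (det-companion z)
    m12′ : m12 (conj z B′) ≡ + M
    m12′ = trans (cong m12 (conj-⊗-companion z B)) m12≡M
    row′ : row B′ ≡ (+ β , A ⊖ k ℕ.* β)
    row′ = begin
      row B′                        ≡⟨ row-⊗-companion z B ⟩
      (- m12 B , m11 B + z * m12 B) ≡⟨ cong (λ (a , b) → (- b , a + z * b)) row≡ ⟩
      (- - + β , + A + z * - + β)   ≡⟨ cong₂ _,_ (neg-involutive (+ β)) (cong (_+_ (+ A)) (sym (neg-distribʳ-* z (+ β)))) ⟩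
      (+ β , + A - z * + β)         ≡⟨ cong (λ x → + β , + A - x) (sym (pos-* k β)) ⟩
      (+ β , + A - + (k ℕ.* β))     ≡⟨ cong (+ β ,_) (m-n≡m⊖n A (k ℕ.* β)) ⟩
      (+ β , A ⊖ k ℕ.* β)           ∎
    turn : Tri (k ℕ.* β < A) (k ℕ.* β ≡ A) (A < k ℕ.* β) → Normal z B′
    turn (tri< kβ<A _ _) =
      positive det′ (β , A ℕ.∸ k ℕ.* β , trans row′ (cong (+ β ,_) (⊖-≥ (ℕ.<⇒≤ kβ<A))) , 0<β , ℕ.m<n⇒0<n∸m kβ<A)
    turn (tri≈ _ kβ≡A _) =
      ⊥-elim (no-zero B′ det′ m12′ 2≤M (inj₂ (trans (cong proj₂ row′) (trans (cong (A ⊖_) kβ≡A) (n⊖n≡0 A)))))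
    turn (tri> _ _ A<kβ) with ℕ.≤-<-connex A (k ℕ.* β ℕ.∸ A)
    ... | inj₁ A≤e = ⊥-elim (nonzero 2≤M (form-degenerate {k = k} (form-mixed {k} B row≡ m12≡M) β≤A (double≤ (ℕ.<⇒≤ A<kβ) A≤e)))
    ... | inj₂ e<A = recurse B′ (subst (β ℕ.+ (k ℕ.* β ℕ.∸ A) <_) (ℕ.+-comm β A) (ℕ.+-monoʳ-< β e<A))
                       (mixed-row det′ m12′ (trans row′ (cong (+ β ,_) (⊖-< A<kβ))) 0<β (ℕ.m<n⇒0<n∸m A<kβ))

  step-adj-companion : ∀ {k M A β B} → 2 ≤ M → A < β → MixedRow k M A β B → Below k M (A ℕ.+ β) →
                       Normal (+ k) (B ⊗ adj (companion (+ k)))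
  step-adj-companion {k} {M} {A} {β} {B} 2≤M A<β (mixed-row det≡1 m12≡M row≡ 0<A 0<β) recurse = turn (ℕ.<-cmp (k ℕ.* A) β)
    where
    open ≡-Reasoning
    z : ℤ
    z = + k
    B′ : Mat
    B′ = B ⊗ adj (companion z)
    det′ : det B′ ≡ 1ℤ
    det′ = det-⊗-≡1 B (adj (companion z)) det≡1 (trans (det-adj (companion z)) (det-companion z))
    m12′ : m12 (conj z B′) ≡ + M
    m12′ = trans (cong m12 (conj-⊗-adj-companion z B)) m12≡M
    row′ : row B′ ≡ (k ℕ.* A ⊖ β , - + A)
    row′ = begin
      row B′                        ≡⟨ row-⊗-adj-companion z B ⟩
      (z * m11 B + m12 B , - m11 B) ≡⟨ cong (λ (a , b) → (z * a + b , - a)) row≡ ⟩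
      (z * + A - + β , - + A)       ≡⟨ cong (λ x → (x - + β , - + A)) (sym (pos-* k A)) ⟩
      (+ (k ℕ.* A) - + β , - + A)   ≡⟨ cong (_, - + A) (m-n≡m⊖n (k ℕ.* A) β) ⟩
      (k ℕ.* A ⊖ β , - + A)         ∎
    swapped : M ℕ.+ k ℕ.* β ℕ.* A ≡ β ℕ.* β ℕ.+ A ℕ.* A
    swapped = begin
      M ℕ.+ k ℕ.* β ℕ.* A    ≡⟨ cong (M ℕ.+_) (swap-last k β A) ⟩
      M ℕ.+ k ℕ.* A ℕ.* β    ≡⟨ form-mixed {k} B row≡ m12≡M ⟩
      A ℕ.* A ℕ.+ β ℕ.* β    ≡⟨ ℕ.+-comm (A ℕ.* A) (β ℕ.* β) ⟩
      β ℕ.* β ℕ.+ A ℕ.* A    ∎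
    turn : Tri (k ℕ.* A < β) (k ℕ.* A ≡ β) (β < k ℕ.* A) → Normal z B′
    turn (tri< kA<β _ _) = Normal-cong (conj-negate z B′)
      (positive (trans (det-negate B′) det′) (β ℕ.∸ k ℕ.* A , A , row″ , ℕ.m<n⇒0<n∸m kA<β , 0<A))
      where
      row″ : row (negate B′) ≡ (+ (β ℕ.∸ k ℕ.* A) , + A)
      row″ = begin
        row (negate B′)                       ≡⟨ row-negate B′ ⟩
        (- m11 B′ , - m12 B′)                 ≡⟨ cong (λ (a , b) → (- a , - b)) row′ ⟩
        (- (k ℕ.* A ⊖ β) , - - + A)           ≡⟨ cong₂ _,_ (cong -_ (⊖-< kA<β)) refl ⟩
        (- - + (β ℕ.∸ k ℕ.* A) , - - + A)     ≡⟨ cong₂ _,_ (neg-involutive _) (neg-involutive (+ A)) ⟩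
        (+ (β ℕ.∸ k ℕ.* A) , + A)             ∎
    turn (tri≈ _ kA≡β _) =
      ⊥-elim (no-zero B′ det′ m12′ 2≤M (inj₁ (trans (cong proj₁ row′) (trans (cong (_⊖ β) kA≡β) (n⊖n≡0 β)))))
    turn (tri> _ _ β<kA) with ℕ.≤-<-connex β (k ℕ.* A ℕ.∸ β)
    ... | inj₁ β≤e = ⊥-elim (nonzero 2≤M (form-degenerate {k = k} swapped (ℕ.<⇒≤ A<β) (double≤ (ℕ.<⇒≤ β<kA) β≤e)))
    ... | inj₂ e<β = recurse B′ (subst (k ℕ.* A ℕ.∸ β ℕ.+ A <_) (ℕ.+-comm β A) (ℕ.+-monoˡ-< A e<β))
                       (mixed-row det′ m12′ (trans row′ (cong (_, - + A) (⊖-≥ (ℕ.<⇒≤ β<kA)))) (ℕ.m<n⇒0<n∸m β<kA) 0<A)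

  mixed : ∀ {k M A β} B → Acc _<_ (A ℕ.+ β) → 2 ≤ M → MixedRow k M A β B → Normal (+ k) B
  mixed {k} {A = A} {β} B (acc smaller) 2≤M row with ℕ.≤-<-connex β A
  ... | inj₁ β≤A = Normal-cong (conj-⊗-companion (+ k) B)
                     (step-companion 2≤M β≤A row (λ B′ lt → mixed B′ (smaller lt) 2≤M))
  ... | inj₂ A<β = Normal-cong (conj-⊗-adj-companion (+ k) B)
                     (step-adj-companion 2≤M A<β row (λ B′ lt → mixed B′ (smaller lt) 2≤M))

  normalise : ∀ {k M} B → det B ≡ 1ℤ → m12 (conj (+ k) B) ≡ + M → 2 ≤ M → Normal (+ k) B
  normalise {k} B det≡1 conj≡M 2≤M = by-signs (m11 B) (m12 B) refl refl
    where
    by-signs : ∀ a b → m11 B ≡ a → m12 B ≡ b → Normal (+ k) B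
    by-signs +0 _ a≡ _ = ⊥-elim (no-zero B det≡1 conj≡M 2≤M (inj₁ a≡))
    by-signs +[1+ x ] +0 _ b≡ = ⊥-elim (no-zero B det≡1 conj≡M 2≤M (inj₂ b≡))
    by-signs -[1+ x ] +0 _ b≡ = ⊥-elim (no-zero B det≡1 conj≡M 2≤M (inj₂ b≡))
    by-signs +[1+ x ] +[1+ y ] a≡ b≡ = positive det≡1 (suc x , suc y , cong₂ _,_ a≡ b≡ , s≤s z≤n , s≤s z≤n)
    by-signs -[1+ x ] -[1+ y ] a≡ b≡ = Normal-cong (conj-negate (+ k) B)
      (positive (trans (det-negate B) det≡1) (suc x , suc y , trans (row-negate B) (cong₂ _,_ (cong -_ a≡) (cong -_ b≡)) , s≤s z≤n , s≤s z≤n))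
    by-signs +[1+ x ] -[1+ y ] a≡ b≡ =
      mixed B (<-wellFounded _) 2≤M (mixed-row det≡1 conj≡M (cong₂ _,_ a≡ b≡) (s≤s z≤n) (s≤s z≤n))
    by-signs -[1+ x ] +[1+ y ] a≡ b≡ = Normal-cong (conj-negate (+ k) B)
      (mixed (negate B) (<-wellFounded _) 2≤M
        (mixed-row (trans (det-negate B) det≡1) (trans (cong m12 (conj-negate (+ k) B)) conj≡M)
                   (trans (row-negate B) (cong₂ _,_ (cong -_ a≡) (cong -_ b≡))) (s≤s z≤n) (s≤s z≤n)))

module Realisation where

  open Matrix
  open HirzebruchJung
  open SternBrocot
  open DualWahlChains
  open Reduction
  open import Defs using (DualWahl)
  open import Data.Integer using (ℤ; +_; -_; _+_; _-_; _*_; 1ℤ)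
  open import Data.Integer.Tactic.RingSolver using (solve)
  open import Data.List using (List; []; _∷_)
  open import Data.Nat as ℕ using (_≤_)
  open import Data.Product using (∃₂; _×_; _,_)
  open import Relation.Binary.PropositionalEquality using (_≡_; refl; sym; trans; cong; cong₂; module ≡-Reasoning)
  open ≡-Reasoning

  same-row⇒shear : ∀ A B → det A ≡ 1ℤ → det B ≡ 1ℤ → row A ≡ row B →
                   B ≡ shear (m21 B * m22 A - m22 B * m21 A) ⊗ A
  same-row⇒shear (mk a b c d) (mk .a .b c′ d′) detA≡1 detB≡1 refl =
    sym (mk-cong (solve vs) (solve vs) third fourth)
    where
    vs : List ℤ
    vs = a ∷ b ∷ c ∷ d ∷ c′ ∷ d′ ∷ []
    third : (c′ * d - d′ * c) * a + 1ℤ * c ≡ c′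
    third = begin
      (c′ * d - d′ * c) * a + 1ℤ * c                                ≡⟨ solve vs ⟩
      c′ + c′ * (a * d - b * c - 1ℤ) + (- c) * (a * d′ - b * c′ - 1ℤ) ≡⟨ x+e*[d-1]≡x _ (- c) _ detB≡1 ⟩
      c′ + c′ * (a * d - b * c - 1ℤ)                                ≡⟨ x+e*[d-1]≡x c′ c′ _ detA≡1 ⟩
      c′                                                            ∎
    fourth : (c′ * d - d′ * c) * b + 1ℤ * d ≡ d′
    fourth = begin
      (c′ * d - d′ * c) * b + 1ℤ * d                                ≡⟨ solve vs ⟩
      d′ + d′ * (a * d - b * c - 1ℤ) + (- d) * (a * d′ - b * c′ - 1ℤ) ≡⟨ x+e*[d-1]≡x _ (- d) _ detB≡1 ⟩
      d′ + d′ * (a * d - b * c - 1ℤ)                                ≡⟨ x+e*[d-1]≡x d′ d′ _ detA≡1 ⟩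
      d′                                                            ∎

  m22-shear-conjugate : ∀ n Y → m22 (shear n ⊗ Y ⊗ adj (shear n)) ≡ m22 Y + n * m12 Y
  m22-shear-conjugate n (mk p q r s) = cong m22 product
    where
    vs : List ℤ
    vs = n ∷ p ∷ q ∷ r ∷ s ∷ []
    product : shear n ⊗ mk p q r s ⊗ adj (shear n) ≡ mk (p - n * q) q (n * p + r - n * (n * q + s)) (s + n * q)
    product = mk-cong (solve vs) (solve vs) (solve vs) (solve vs)

  m22-conj-shear : ∀ z n X → m22 (conj z (shear n ⊗ X)) ≡ m22 (conj z X) + n * m12 (conj z X)
  m22-conj-shear z n X = trans (cong m22 (conj-⊗ z (shear n) X)) (m22-shear-conjugate n (conj z X))

  realise : ∀ {k M} B → det B ≡ 1ℤ → m12 (conj (+ k) B) ≡ + M → 2 ≤ M →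
            ∃₂ λ c n → DualWahl k c × column (chainMat c) ≡ (+ M , m22 (conj (+ k) B) + n * + M)
  realise {k} {M} B det≡1 conj≡M 2≤M with normalise B det≡1 conj≡M 2≤M
  ... | normal {Bn} detBn≡1 same-conj (x , y , row≡ , 0<x , 0<y) with stern-brocot Bn detBn≡1 row≡ 0<x 0<y
  ... | p , row-p with wahl-word k p
  ... | c , wahl , realises = c , n , wahl , trans (column-realised {k} {c} {B′} realises) (cong₂ _,_ m12≡ m22≡)
    where
    z : ℤ
    z = + k
    B′ : Mat
    B′ = upper ⊗ word p
    n : ℤ
    n = m21 B′ * m22 Bn - m22 B′ * m21 Bn
    m12≡ : m12 (conj z B′) ≡ + M
    m12≡ = begin
      m12 (conj z B′)               ≡⟨ m12-conj z B′ ⟩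
      form z (m11 B′) (m12 B′)      ≡⟨ cong (λ (a , b) → form z a b) (trans row-p (sym row≡)) ⟩
      form z (m11 Bn) (m12 Bn)      ≡⟨ m12-conj z Bn ⟨
      m12 (conj z Bn)               ≡⟨ cong m12 same-conj ⟩
      m12 (conj z B)                ≡⟨ conj≡M ⟩
      + M                           ∎
    m22≡ : m22 (conj z B′) ≡ m22 (conj z B) + n * + M
    m22≡ = begin
      m22 (conj z B′)                         ≡⟨ cong (λ X → m22 (conj z X)) shear≡ ⟩
      m22 (conj z (shear n ⊗ Bn))             ≡⟨ m22-conj-shear z n Bn ⟩
      m22 (conj z Bn) + n * m12 (conj z Bn)   ≡⟨ cong (λ X → m22 X + n * m12 X) same-conj ⟩
      m22 (conj z B) + n * m12 (conj z B)     ≡⟨ cong (λ m → m22 (conj z B) + n * m) conj≡M ⟩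
      m22 (conj z B) + n * + M                ∎
      where
      shear≡ : B′ ≡ shear n ⊗ Bn
      shear≡ = same-row⇒shear Bn B′ detBn≡1 (det-⊗-≡1 upper (word p) refl (det-word p)) (trans row≡ (sym row-p))

module CohnTriples where

  open Matrix
  open import Defs
  open import Data.Integer using (ℤ; +_; -_; _+_; _-_; _*_; 0ℤ; 1ℤ; -1ℤ)
  open import Data.Integer.Properties using (+-injective; pos-+; pos-*; neg-involutive)
  open import Data.Integer.Tactic.RingSolver using (solve)
  open import Data.List using ([]; _∷_)
  open import Data.Nat as ℕ using (ℕ; suc; zero; _<_; s≤s; z≤n)
  open import Data.Nat.Coprimality as Coprime using (Coprime; coprime-divisor)
  open import Data.Nat.DivMod using (m*n/n≡m)
  open import Data.Nat.Divisibility using (_∣_; ∣-trans; ∣m⇒∣m*n; ∣n⇒∣m*n; ∣m∣n⇒∣m+n; ∣m+n∣m⇒∣n)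
  import Data.Nat.Properties as ℕ
  open import Data.Product using (_×_; _,_; proj₁; proj₂)
  open import Relation.Binary.PropositionalEquality using (_≡_; refl; sym; trans; cong; cong₂; subst; module ≡-Reasoning)
  open ≡-Reasoning

  -- Exchange relations behind the recursion of MT(k).
  m12-conjugateˡ : ∀ X Y → det Y ≡ 1ℤ → m12 (X ⊗ Y ⊗ adj X) * m12 Y ≡ form (m11 Y + m22 Y) (m12 (X ⊗ Y)) (- m12 X)
  m12-conjugateˡ (mk a b c d) (mk e f g h) det≡1 = begin
    ((a * e + b * g) * - b + (a * f + b * h) * a) * f                       ≡⟨ solve (a ∷ b ∷ e ∷ f ∷ g ∷ h ∷ []) ⟩
    (a * f + b * h) * (a * f + b * h) + (e + h) * (a * f + b * h) * - b + - b * - b + b * b * (e * h - f * g - 1ℤ)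
                                                                            ≡⟨ x+e*[d-1]≡x _ (b * b) _ det≡1 ⟩
    (a * f + b * h) * (a * f + b * h) + (e + h) * (a * f + b * h) * - b + - b * - b
                                                                            ∎

  m12-conjugateʳ : ∀ X Y → det Y ≡ 1ℤ → m12 (adj X ⊗ Y ⊗ X) * m12 Y ≡ form (m11 Y + m22 Y) (m12 (Y ⊗ X)) (- m12 X)
  m12-conjugateʳ (mk a b c d) (mk e f g h) det≡1 = begin
    ((d * e + - b * g) * b + (d * f + - b * h) * d) * f                     ≡⟨ solve (b ∷ d ∷ e ∷ f ∷ g ∷ h ∷ []) ⟩
    (e * b + f * d) * (e * b + f * d) + (e + h) * (e * b + f * d) * - b + - b * - b + b * b * (e * h - f * g - 1ℤ)
                                                                            ≡⟨ x+e*[d-1]≡x _ (b * b) _ det≡1 ⟩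
    (e * b + f * d) * (e * b + f * d) + (e + h) * (e * b + f * d) * - b + - b * - b
                                                                            ∎

  ⊗-solveˡ : ∀ X Y Z → det X ≡ 1ℤ → X ⊗ Y ≡ Z → Y ≡ adj X ⊗ Z
  ⊗-solveˡ X Y Z det≡1 XY≡Z = begin
    Y                ≡⟨ ⊗-identityˡ Y ⟨
    I ⊗ Y            ≡⟨ cong (_⊗ Y) (⊗-inverseˡ X det≡1) ⟨
    adj X ⊗ X ⊗ Y    ≡⟨ ⊗-assoc (adj X) X Y ⟩
    adj X ⊗ (X ⊗ Y)  ≡⟨ cong (adj X ⊗_) XY≡Z ⟩
    adj X ⊗ Z        ∎

  ⊗-solveʳ : ∀ X Y Z → det Y ≡ 1ℤ → X ⊗ Y ≡ Z → X ≡ Z ⊗ adj Y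
  ⊗-solveʳ X Y Z det≡1 XY≡Z = begin
    X                ≡⟨ ⊗-identityʳ X ⟨
    X ⊗ I            ≡⟨ cong (X ⊗_) (⊗-inverseʳ Y det≡1) ⟨
    X ⊗ (Y ⊗ adj Y)  ≡⟨ ⊗-assoc X Y (adj Y) ⟨
    X ⊗ Y ⊗ adj Y    ≡⟨ cong (_⊗ adj Y) XY≡Z ⟩
    Z ⊗ adj Y        ∎

  m12-adj-⊗-shear : ∀ X n → m12 (adj X ⊗ shear n) ≡ - m12 X
  m12-adj-⊗-shear (mk a b c d) n = begin
    d * 0ℤ + - b * 1ℤ  ≡⟨ solve (b ∷ d ∷ []) ⟩
    - b                ∎

  m12-shear-⊗-adj : ∀ n X → m12 (shear n ⊗ adj X) ≡ - m12 X
  m12-shear-⊗-adj n (mk a b c d) = begin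
    1ℤ * - b + 0ℤ * a  ≡⟨ solve (a ∷ b ∷ []) ⟩
    - b                ∎

  cancel-conjugateˡ : ∀ W X Y → det X ≡ 1ℤ → W ⊗ (X ⊗ Y ⊗ adj X) ⊗ X ≡ W ⊗ X ⊗ Y
  cancel-conjugateˡ W X Y det≡1 = begin
    W ⊗ (X ⊗ Y ⊗ adj X) ⊗ X      ≡⟨ ⊗-assoc W (X ⊗ Y ⊗ adj X) X ⟩
    W ⊗ (X ⊗ Y ⊗ adj X ⊗ X)      ≡⟨ cong (W ⊗_) (⊗-assoc (X ⊗ Y) (adj X) X) ⟩
    W ⊗ (X ⊗ Y ⊗ (adj X ⊗ X))    ≡⟨ cong (λ V → W ⊗ (X ⊗ Y ⊗ V)) (⊗-inverseˡ X det≡1) ⟩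
    W ⊗ (X ⊗ Y ⊗ I)              ≡⟨ cong (W ⊗_) (⊗-identityʳ (X ⊗ Y)) ⟩
    W ⊗ (X ⊗ Y)                  ≡⟨ ⊗-assoc W X Y ⟨
    W ⊗ X ⊗ Y                    ∎

  cancel-conjugateʳ : ∀ X Y V → det X ≡ 1ℤ → X ⊗ (adj X ⊗ Y ⊗ X) ⊗ V ≡ Y ⊗ X ⊗ V
  cancel-conjugateʳ X Y V det≡1 = cong (_⊗ V) (begin
    X ⊗ (adj X ⊗ Y ⊗ X)          ≡⟨ ⊗-assoc X (adj X ⊗ Y) X ⟨
    X ⊗ (adj X ⊗ Y) ⊗ X          ≡⟨ cong (_⊗ X) (⊗-assoc X (adj X) Y) ⟨
    X ⊗ adj X ⊗ Y ⊗ X            ≡⟨ cong (λ U → U ⊗ Y ⊗ X) (⊗-inverseʳ X det≡1) ⟩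
    I ⊗ Y ⊗ X                    ≡⟨ cong (_⊗ X) (⊗-identityˡ Y) ⟩
    Y ⊗ X                        ∎)

  exact-division : ∀ {Q c} x → 0 < c → x * + c ≡ + Q → x ≡ + divE Q c × divE Q c ℕ.* c ≡ Q
  exact-division {Q} {suc c} (+ q) _ eq with +-injective (trans (pos-* q (suc c)) eq)
  ... | refl = cong +_ (sym (m*n/n≡m q (suc c))) , cong (ℕ._* suc c) (m*n/n≡m q (suc c))

  form-ℕ : ℕ → ℕ → ℕ → ℕ
  form-ℕ k a b = a ℕ.* a ℕ.+ k ℕ.* a ℕ.* b ℕ.+ b ℕ.* b

  +-form : ∀ k a b → + form-ℕ k a b ≡ form (+ k) (+ a) (+ b)
  +-form k a b = begin
    + (a ℕ.* a ℕ.+ k ℕ.* a ℕ.* b ℕ.+ b ℕ.* b)          ≡⟨ pos-+ (a ℕ.* a ℕ.+ k ℕ.* a ℕ.* b) (b ℕ.* b) ⟩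
    + (a ℕ.* a ℕ.+ k ℕ.* a ℕ.* b) + + (b ℕ.* b)        ≡⟨ cong (_+ + (b ℕ.* b)) (pos-+ (a ℕ.* a) (k ℕ.* a ℕ.* b)) ⟩
    + (a ℕ.* a) + + (k ℕ.* a ℕ.* b) + + (b ℕ.* b)      ≡⟨ cong₂ (λ x y → x + y + + (b ℕ.* b)) (pos-* a a) (trans (pos-* (k ℕ.* a) b) (cong (_* + b) (pos-* k a))) ⟩
    + a * + a + + k * + a * + b + + (b ℕ.* b)          ≡⟨ cong (_+_ (+ a * + a + + k * + a * + b)) (pos-* b b) ⟩
    form (+ k) (+ a) (+ b)                             ∎

  form-positive : ∀ k a b → 0 < a → 0 < form-ℕ k a b
  form-positive k (suc a) b _ = s≤s z≤n

  coprime-step : ∀ k {a b c M} → Coprime a b → M ℕ.* c ≡ form-ℕ k a b → Coprime a M × Coprime M b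
  coprime-step k {a} {b} {c} {M} cop M*c≡ = coprime-aM , coprime-Mb
    where
    divides-form : ∀ {d} → d ∣ M → d ∣ form-ℕ k a b
    divides-form {d} d∣M = subst (d ∣_) M*c≡ (∣m⇒∣m*n c d∣M)
    divides-kab : ∀ {d} → d ∣ a → d ∣ k ℕ.* a ℕ.* b
    divides-kab d∣a = ∣m⇒∣m*n b (∣n⇒∣m*n k d∣a)
    coprime-aM : Coprime a M
    coprime-aM {d} (d∣a , d∣M) = cop (d∣a , coprime-divisor d⊥b d∣bb)
      where
      d⊥b : Coprime d b
      d⊥b (e∣d , e∣b) = cop (∣-trans e∣d d∣a , e∣b)
      d∣bb : d ∣ b ℕ.* b
      d∣bb = ∣m+n∣m⇒∣n (divides-form d∣M) (∣m∣n⇒∣m+n (∣m⇒∣m*n a d∣a) (divides-kab d∣a))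
    coprime-Mb : Coprime M b
    coprime-Mb {d} (d∣M , d∣b) = cop (coprime-divisor d⊥a d∣aa , d∣b)
      where
      d⊥a : Coprime d a
      d⊥a (e∣d , e∣a) = cop (e∣a , ∣-trans e∣d d∣b)
      rest : d ∣ k ℕ.* a ℕ.* b ℕ.+ b ℕ.* b
      rest = ∣m∣n⇒∣m+n (∣n⇒∣m*n (k ℕ.* a) d∣b) (∣m⇒∣m*n b d∣b)
      d∣aa : d ∣ a ℕ.* a
      d∣aa = ∣m+n∣m⇒∣n (subst (d ∣_) (ℕ.+-comm (a ℕ.* a) _) (subst (d ∣_) (ℕ.+-assoc (a ℕ.* a) _ _) (divides-form d∣M))) rest

  record CohnTriple (k : ℕ) (v : MTriple) : Set where
    field
      Bl Bm Br        : Mat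
      det-l           : det Bl ≡ 1ℤ
      det-m           : det Bm ≡ 1ℤ
      det-r           : det Br ≡ 1ℤ
      p               : ℤ
      product         : conj (+ k) Bl ⊗ conj (+ k) Bm ⊗ conj (+ k) Br ≡ shear p
      m12-l           : m12 (conj (+ k) Bl) ≡ + ml v
      m12-m           : m12 (conj (+ k) Bm) ≡ + mm v
      m12-r           : m12 (conj (+ k) Br) ≡ + mr v
      0<l             : 0 < ml v
      0<m             : 0 < mm v
      0<r             : 0 < mr v
      coprime-lm      : Coprime (ml v) (mm v)
      coprime-mr      : Coprime (mm v) (mr v)

    Kl Km Kr : Mat
    Kl = conj (+ k) Bl
    Km = conj (+ k) Bm
    Kr = conj (+ k) Br

    m12-Kl⊗Km : m12 (Kl ⊗ Km) ≡ - + mr v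
    m12-Kl⊗Km = begin
      m12 (Kl ⊗ Km)                ≡⟨ cong m12 (⊗-solveʳ (Kl ⊗ Km) Kr (shear p) (det-conj (+ k) Br det-r) product) ⟩
      m12 (shear p ⊗ adj Kr)       ≡⟨ m12-shear-⊗-adj p Kr ⟩
      - m12 Kr                     ≡⟨ cong -_ m12-r ⟩
      - + mr v                     ∎

    m12-Km⊗Kr : m12 (Km ⊗ Kr) ≡ - + ml v
    m12-Km⊗Kr = begin
      m12 (Km ⊗ Kr)                ≡⟨ cong m12 (⊗-solveˡ Kl (Km ⊗ Kr) (shear p) (det-conj (+ k) Bl det-l)
                                                   (trans (sym (⊗-assoc Kl Km Kr)) product)) ⟩
      m12 (adj Kl ⊗ shear p)       ≡⟨ m12-adj-⊗-shear Kl p ⟩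
      - m12 Kl                     ≡⟨ cong -_ m12-l ⟩
      - + ml v                     ∎

    -- The first row of Kl ⊗ Km = shear p ⊗ adj Kr, i.e. l · m₂₂(Km) + r ≡ 0 (mod m).
    middle-congruence : + ml v * m22 Km + + mr v ≡ - m11 Kl * + mm v
    middle-congruence = begin
      + ml v * m22 Km + + mr v              ≡⟨ cong₂ (λ a b → a * m22 Km + b) (sym m12-l) r≡ ⟩
      m12 Kl * m22 Km + - m12 (Kl ⊗ Km)     ≡⟨ first-row Kl Km ⟩
      - m11 Kl * m12 Km                     ≡⟨ cong (λ x → - m11 Kl * x) m12-m ⟩
      - m11 Kl * + mm v                     ∎
      where
      r≡ : + mr v ≡ - m12 (Kl ⊗ Km)
      r≡ = trans (sym (neg-involutive (+ mr v))) (cong -_ (sym m12-Kl⊗Km))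
      first-row : ∀ X Y → m12 X * m22 Y + - m12 (X ⊗ Y) ≡ - m11 X * m12 Y
      first-row (mk a b c d) (mk e f g h) = begin
        b * h + - (a * f + b * h)  ≡⟨ solve (a ∷ b ∷ f ∷ h ∷ []) ⟩
        - a * f                    ∎

  form-neg : ∀ z a b → form z (- a) (- b) ≡ form z a b
  form-neg z a b = begin
    - a * - a + z * - a * - b + - b * - b  ≡⟨ solve (z ∷ a ∷ b ∷ []) ⟩
    a * a + z * a * b + b * b              ∎

  form-neg-swap : ∀ z a b → form z (- a) (- b) ≡ form z b a
  form-neg-swap z a b = begin
    - a * - a + z * - a * - b + - b * - b  ≡⟨ solve (z ∷ a ∷ b ∷ []) ⟩
    b * b + z * b * a + a * a              ∎

  quotient-positive : ∀ {M c Q} → 0 < Q → M ℕ.* c ≡ Q → 0 < M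
  quotient-positive {suc M} _ _ = s≤s z≤n
  quotient-positive {zero} 0<Q refl = 0<Q

  cohn-left : ∀ {k v} → CohnTriple k v → CohnTriple k (mtLeft k v)
  cohn-left {k} {mtri l m r} C = record
    { Bl = Bl ; Bm = Km ⊗ Br ; Br = Bm
    ; det-l = det-l ; det-m = det-⊗-≡1 Km Br detKm det-r ; det-r = det-m
    ; p = p
    ; product = begin
        Kl ⊗ conj z (Km ⊗ Br) ⊗ Km         ≡⟨ cong (λ X → Kl ⊗ X ⊗ Km) (conj-⊗ z Km Br) ⟩
        Kl ⊗ (Km ⊗ Kr ⊗ adj Km) ⊗ Km        ≡⟨ cancel-conjugateˡ Kl Km Kr detKm ⟩
        Kl ⊗ Km ⊗ Kr                        ≡⟨ product ⟩
        shear p                             ∎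
    ; m12-l = m12-l ; m12-m = trans (cong m12 (conj-⊗ z Km Br)) (proj₁ division) ; m12-r = m12-m
    ; 0<l = 0<l ; 0<m = quotient-positive (form-positive k l m 0<l) (proj₂ division) ; 0<r = 0<m
    ; coprime-lm = proj₁ coprime ; coprime-mr = proj₂ coprime
    }
    where
    open CohnTriple C
    z : ℤ
    z = + k
    detKm : det Km ≡ 1ℤ
    detKm = det-conj z Bm det-m
    markov : m12 (Km ⊗ Kr ⊗ adj Km) * + r ≡ + form-ℕ k l m
    markov = begin
      m12 (Km ⊗ Kr ⊗ adj Km) * + r                        ≡⟨ cong (m12 (Km ⊗ Kr ⊗ adj Km) *_) m12-r ⟨
      m12 (Km ⊗ Kr ⊗ adj Km) * m12 Kr                     ≡⟨ m12-conjugateˡ Km Kr (det-conj z Br det-r) ⟩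
      form (m11 Kr + m22 Kr) (m12 (Km ⊗ Kr)) (- m12 Km)   ≡⟨ cong₂ (λ t x → form t x (- m12 Km)) (trace-conj z Br det-r) m12-Km⊗Kr ⟩
      form z (- + l) (- m12 Km)                           ≡⟨ cong (λ x → form z (- + l) (- x)) m12-m ⟩
      form z (- + l) (- + m)                              ≡⟨ form-neg z (+ l) (+ m) ⟩
      form z (+ l) (+ m)                                  ≡⟨ +-form k l m ⟨
      + form-ℕ k l m                                      ∎
    division : m12 (Km ⊗ Kr ⊗ adj Km) ≡ + divE (form-ℕ k l m) r × divE (form-ℕ k l m) r ℕ.* r ≡ form-ℕ k l m
    division = exact-division (m12 (Km ⊗ Kr ⊗ adj Km)) 0<r markov
    coprime : Coprime l (divE (form-ℕ k l m) r) × Coprime (divE (form-ℕ k l m) r) m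
    coprime = coprime-step k coprime-lm (proj₂ division)

  cohn-right : ∀ {k v} → CohnTriple k v → CohnTriple k (mtRight k v)
  cohn-right {k} {mtri l m r} C = record
    { Bl = Bm ; Bm = adj Km ⊗ Bl ; Br = Br
    ; det-l = det-m ; det-m = det-⊗-≡1 (adj Km) Bl (trans (det-adj Km) detKm) det-l ; det-r = det-r
    ; p = p
    ; product = begin
        Km ⊗ conj z (adj Km ⊗ Bl) ⊗ Kr      ≡⟨ cong (λ X → Km ⊗ X ⊗ Kr) conj≡ ⟩
        Km ⊗ (adj Km ⊗ Kl ⊗ Km) ⊗ Kr         ≡⟨ cancel-conjugateʳ Km Kl Kr detKm ⟩
        Kl ⊗ Km ⊗ Kr                         ≡⟨ product ⟩
        shear p                              ∎
    ; m12-l = m12-m ; m12-m = trans (cong m12 conj≡) (proj₁ division) ; m12-r = m12-r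
    ; 0<l = 0<m ; 0<m = quotient-positive (form-positive k m r 0<m) (proj₂ division) ; 0<r = 0<r
    ; coprime-lm = proj₁ coprime ; coprime-mr = proj₂ coprime
    }
    where
    open CohnTriple C
    z : ℤ
    z = + k
    detKm : det Km ≡ 1ℤ
    detKm = det-conj z Bm det-m
    conj≡ : conj z (adj Km ⊗ Bl) ≡ adj Km ⊗ Kl ⊗ Km
    conj≡ = trans (conj-⊗ z (adj Km) Bl) (cong (adj Km ⊗ Kl ⊗_) (adj-involutive Km))
    markov : m12 (adj Km ⊗ Kl ⊗ Km) * + l ≡ + form-ℕ k m r
    markov = begin
      m12 (adj Km ⊗ Kl ⊗ Km) * + l                        ≡⟨ cong (m12 (adj Km ⊗ Kl ⊗ Km) *_) m12-l ⟨
      m12 (adj Km ⊗ Kl ⊗ Km) * m12 Kl                     ≡⟨ m12-conjugateʳ Km Kl (det-conj z Bl det-l) ⟩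
      form (m11 Kl + m22 Kl) (m12 (Kl ⊗ Km)) (- m12 Km)   ≡⟨ cong₂ (λ t x → form t x (- m12 Km)) (trace-conj z Bl det-l) m12-Kl⊗Km ⟩
      form z (- + r) (- m12 Km)                           ≡⟨ cong (λ x → form z (- + r) (- x)) m12-m ⟩
      form z (- + r) (- + m)                              ≡⟨ form-neg-swap z (+ r) (+ m) ⟩
      form z (+ m) (+ r)                                  ≡⟨ +-form k m r ⟨
      + form-ℕ k m r                                      ∎
    division : m12 (adj Km ⊗ Kl ⊗ Km) ≡ + divE (form-ℕ k m r) l × divE (form-ℕ k m r) l ℕ.* l ≡ form-ℕ k m r
    division = exact-division (m12 (adj Km ⊗ Kl ⊗ Km)) 0<l markov
    coprime : Coprime m (divE (form-ℕ k m r) l) × Coprime (divE (form-ℕ k m r) l) r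
    coprime = coprime-step k coprime-mr (proj₂ division)

  cohn-root : ∀ k → CohnTriple k (mtRoot k)
  cohn-root k = record
    { Bl = lower ; Bm = upper ; Br = shear (- + k)
    ; det-l = refl ; det-m = refl ; det-r = det-shear (+ k)
    ; p = + 3 * + k + + 3
    ; product = root-product (+ k)
    ; m12-l = cong m12 (conj-lower (+ k)) ; m12-m = trans (cong m12 (conj-upper (+ k))) (sym (pos-+ k 2))
    ; m12-r = cong m12 (conj-shear (+ k))
    ; 0<l = s≤s z≤n ; 0<m = ℕ.<-≤-trans (s≤s z≤n) (ℕ.m≤n+m 2 k) ; 0<r = s≤s z≤n
    ; coprime-lm = Coprime.1-coprimeTo (k ℕ.+ 2) ; coprime-mr = Coprime.sym (Coprime.1-coprimeTo (k ℕ.+ 2))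
    }
    where
    det-shear : ∀ z → det (shear (- z)) ≡ 1ℤ
    det-shear z = begin
      1ℤ * 1ℤ - 0ℤ * - z  ≡⟨ solve (z ∷ []) ⟩
      1ℤ                  ∎
    Kl Km Kr : ℤ → Mat
    Kl z = mk -1ℤ 1ℤ (- (z + + 2)) (z + 1ℤ)
    Km z = mk -1ℤ (z + + 2) -1ℤ (z + 1ℤ)
    Kr z = mk z 1ℤ -1ℤ 0ℤ
    conj-lower : ∀ z → conj z lower ≡ Kl z
    conj-lower z = mk-cong (solve (z ∷ [])) (solve (z ∷ [])) (solve (z ∷ [])) (solve (z ∷ []))
    conj-upper : ∀ z → conj z upper ≡ Km z
    conj-upper z = mk-cong (solve (z ∷ [])) (solve (z ∷ [])) (solve (z ∷ [])) (solve (z ∷ []))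
    conj-shear : ∀ z → conj z (shear (- z)) ≡ Kr z
    conj-shear z = mk-cong (solve (z ∷ [])) (solve (z ∷ [])) (solve (z ∷ [])) (solve (z ∷ []))
    root-product : ∀ z → conj z lower ⊗ conj z upper ⊗ conj z (shear (- z)) ≡ shear (+ 3 * z + + 3)
    root-product z = begin
      conj z lower ⊗ conj z upper ⊗ conj z (shear (- z))  ≡⟨ cong₂ (λ X Y → X ⊗ Y ⊗ conj z (shear (- z))) (conj-lower z) (conj-upper z) ⟩
      Kl z ⊗ Km z ⊗ conj z (shear (- z))                  ≡⟨ cong (Kl z ⊗ Km z ⊗_) (conj-shear z) ⟩
      Kl z ⊗ Km z ⊗ Kr z                                  ≡⟨ mk-cong (solve (z ∷ [])) (solve (z ∷ [])) (solve (z ∷ [])) (solve (z ∷ [])) ⟩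
      shear (+ 3 * z + + 3)                               ∎

  cohn : ∀ k path → CohnTriple k (mt k path)
  cohn k path = from path (cohn-root k)
    where
    from : ∀ {v} path → CohnTriple k v → CohnTriple k (mtFrom k v path)
    from [] C = C
    from (L ∷ path) C = from path (cohn-left C)
    from (R ∷ path) C = from path (cohn-right C)

module VertexChain where

  open Matrix
  open HirzebruchJung
  open Realisation using (realise)
  open CohnTriples
  open import Defs
  open import Data.Empty using (⊥-elim)
  open import Data.Integer using (+_; -_; _+_; _-_; _*_)
  open import Data.Integer.Divisibility.Signed using (divides; ∣⇒∣ᵤ)
  open import Data.Integer.Properties using (+-injective; pos-+; pos-*)
  open import Data.Integer.Tactic.RingSolver using (solve)
  open import Data.List using (List; []; _∷_)
  open import Data.Nat as ℕ using (ℕ; suc; zero; _≤_; _<_)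
  open import Data.Nat.Coprimality using (Coprime; coprime-divisor)
  open import Data.Nat.Divisibility using (_∣_; ∣m+n∣m⇒∣n; >⇒∤)
  import Data.Nat.Properties as ℕ
  import Data.Nat.Tactic.RingSolver as ℕ-RingSolver
  open import Data.Product using (∃₂; _×_; _,_; proj₁; proj₂)
  open import Data.Sum using (inj₁; inj₂)
  open import Relation.Binary.PropositionalEquality using (_≡_; refl; sym; trans; cong; subst; module ≡-Reasoning)
  open ≡-Reasoning

  unique-root-≤ : ∀ {m l r x y} → Coprime m l → m ∣ l ℕ.* x ℕ.+ r → m ∣ l ℕ.* y ℕ.+ r → x ≤ y → y < m → x ≡ y
  unique-root-≤ {m} {l} {r} {x} m⊥l m∣x m∣y x≤y y<m with ℕ.m≤n⇒∃[o]m+o≡n x≤y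
  ... | e , refl = sym (trans (cong (x ℕ.+_) (e≡0 e (ℕ.≤-<-trans (ℕ.m≤n+m e x) y<m) m∣e)) (ℕ.+-identityʳ x))
    where
    split : ∀ l x e r → l ℕ.* (x ℕ.+ e) ℕ.+ r ≡ (l ℕ.* x ℕ.+ r) ℕ.+ l ℕ.* e
    split = ℕ-RingSolver.solve-∀
    m∣e : m ∣ e
    m∣e = coprime-divisor m⊥l (∣m+n∣m⇒∣n (subst (m ∣_) (split l x e r) m∣y) m∣x)
    e≡0 : ∀ e → e < m → m ∣ e → e ≡ 0
    e≡0 zero _ _ = refl
    e≡0 (suc e) e<m m∣e = ⊥-elim (>⇒∤ e<m m∣e)

  unique-root : ∀ {m l r x y} → Coprime m l → m ∣ l ℕ.* x ℕ.+ r → m ∣ l ℕ.* y ℕ.+ r → x < m → y < m → x ≡ y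
  unique-root {x = x} {y} m⊥l m∣x m∣y x<m y<m with ℕ.≤-total x y
  ... | inj₁ x≤y = unique-root-≤ m⊥l m∣x m∣y x≤y y<m
  ... | inj₂ y≤x = sym (unique-root-≤ m⊥l m∣y m∣x y≤x x<m)

  record WahlChainAt (k : ℕ) (v : MTriple) : Set where
    field
      chain         : List ℕ
      denominator   : ℕ
      dual-wahl     : DualWahl k chain
      value         : column (chainMat chain) ≡ (+ mm v , + denominator)
      denominator<m : denominator < mm v
      root          : mm v ∣ ml v ℕ.* denominator ℕ.+ mr v

  vertex-chain : ∀ k path → 2 ≤ mm (mt k path) → WahlChainAt k (mt k path)
  vertex-chain k path 2≤m = assemble (realise {k} Bm det-m m12-m 2≤m)
    where
    open CohnTriple (cohn k path)
    v : MTriple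
    v = mt k path
    l m r : ℕ
    l = ml v
    m = mm v
    r = mr v
    rearrange : ∀ a b c n m → a * (b + n * m) + c ≡ (a * b + c) + a * n * m
    rearrange a b c n m = solve (a ∷ b ∷ c ∷ n ∷ m ∷ [])
    collect : ∀ a b n m → - b * m + a * n * m ≡ (a * n - b) * m
    collect a b n m = solve (a ∷ b ∷ n ∷ m ∷ [])
    assemble : (∃₂ λ c n → DualWahl k c × column (chainMat c) ≡ (+ m , m22 Km + n * + m)) → WahlChainAt k v
    assemble (c , n , wahl , column≡) with column-bounds (DualWahl⇒All≥2 wahl)
    ... | N , D , bounds≡ , D<N with refl ← +-injective (trans (sym (cong proj₁ bounds≡)) (cong proj₁ column≡)) =
      record { chain = c ; denominator = D ; dual-wahl = wahl ; value = bounds≡ ; denominator<m = D<N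
             ; root = ∣⇒∣ᵤ (divides (+ l * n - m11 Kl) congruence) }
      where
      congruence : + (l ℕ.* D ℕ.+ r) ≡ (+ l * n - m11 Kl) * + m
      congruence = begin
        + (l ℕ.* D ℕ.+ r)                          ≡⟨ trans (pos-+ (l ℕ.* D) r) (cong (_+ + r) (pos-* l D)) ⟩
        + l * + D + + r                            ≡⟨ cong (λ x → + l * x + + r) (trans (sym (cong proj₂ bounds≡)) (cong proj₂ column≡)) ⟩
        + l * (m22 Km + n * + m) + + r             ≡⟨ rearrange (+ l) (m22 Km) (+ r) n (+ m) ⟩
        (+ l * m22 Km + + r) + + l * n * + m       ≡⟨ cong (_+ + l * n * + m) middle-congruence ⟩
        - m11 Kl * + m + + l * n * + m             ≡⟨ collect (+ l) (m11 Kl) n (+ m) ⟩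
        (+ l * n - m11 Kl) * + m                   ∎

open import Defs
open import Data.Nat using (ℕ; _+_; _*_; _<_; s≤s)
open import Data.Nat.Divisibility using (_∣_)
open import Data.Nat.Coprimality as Coprime using (Coprime)
open import Data.Nat.Properties using (≤-trans)
open import Data.Integer using (+_)
open import Data.List using (List)
open import Data.Product using (_,_)
open import Relation.Binary.PropositionalEquality using (_≡_; sym; subst)
open Matrix using (column)
open HirzebruchJung using (chainMat; DualWahl⇒All≥2; hj-expansion-unique)
open CohnTriples using (CohnTriple; cohn)
open VertexChain using (WahlChainAt; vertex-chain; unique-root)

proposition8p14 : (k p q : ℕ) → Coprime p q → 0 < p → p < q →
    (path : Path) → fm (farey path) ≡ (p , q) →
    (u : ℕ) → 0 < u → u < mm (mt k path) →
    mm (mt k path) ∣ ml (mt k path) * u + mr (mt k path) →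
    (bs : List ℕ) → IsHJExpansion bs (mm (mt k path)) u →
    DualWahl k bs
proposition8p14 k _ _ _ _ _ path _ u 0<u u<m m∣lu+r bs expansion = subst (DualWahl k) (sym bs≡chain) dual-wahl
  where
  open WahlChainAt (vertex-chain k path (≤-trans (s≤s 0<u) u<m))
  u≡denominator : u ≡ denominator
  u≡denominator = unique-root (Coprime.sym (CohnTriple.coprime-lm (cohn k path))) m∣lu+r root u<m denominator<m
  bs≡chain : bs ≡ chain
  bs≡chain = hj-expansion-unique expansion (DualWahl⇒All≥2 dual-wahl)
               (subst (λ x → column (chainMat chain) ≡ (+ mm (mt k path) , + x)) (sym u≡denominator) value)
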